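{- Let $n$ be a positive integer. Let $\mathcal P_e(n,2)$ (resp. $\mathcal P_o(n,2)$) be the set of partitions of $n$ with an even (resp. odd) number of even parts (with multiplicity). Then \[ \sum_{\lambda\in\mathcal P_o(n,2)}\ell_{ev}(\lambda)-\sum_{\lambda\in\mathcal P_e(n,2)}\ell_{ev}(\lambda) \] equals the number of partitions $\lambda$ of $n$ such that exactly one even integer $2k$ ($k\ge1$) occurs as a part, with odd multiplicity $b$, all other parts are odd and distinct, and, writing $\lambda=\lambda^o\cup((2k)^b)$ with $\lambda^o$ a partition into distinct odd parts, we have $\lambda^o_1-\lambda^o_2\le 2k$, $\lambda^o\neq\mu(2k)$, and, if $k$ is even and $b=1$, then $\lambda^o$ is nonempty.
   Context: A partition is a non-increasing sequence of positive integers $\lambda_1\ge\lambda_2\ge\cdots$, with $\lambda_j=0$ for $j$ larger than the number of parts; $\lambda^o$ may be empty. $\ell_{ev}(\lambda)$ is the number of even parts of $\lambda$ with multiplicity; $(c^b)$ is the partition with $b$ parts equal to $c$, and $\cup$ denotes union of multisets of parts. For even $a\ge4$, $\mu(a):=(\frac a2+1,\frac a2-1)$ if $\frac a2$ is even and $\mu(a):=(\frac a2+2,\frac a2-2)$ if $\frac a2$ is odd; for $k=1$ the condition $\lambda^o\neq\mu(2)$ is vacuous. -}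

module Defs where

open import Data.Nat using (ℕ; zero; suc; _+_; _*_; _∸_; _≤_; _<_; _≥_; _>_; _%_)
open import Data.Nat.Properties using (_≟_)
open import Data.Nat.ListAction using (sum)
open import Data.List using (List; []; _∷_; length; filter; map; replicate; _++_)
open import Data.List.Relation.Unary.All using (All)
open import Data.List.Relation.Unary.Linked using (Linked)
open import Data.List.Relation.Binary.Permutation.Propositional using (_↭_)
open import Data.Integer as ℤ using (ℤ; +_)
open import Data.Product using (Σ; _×_; ∃; ∃-syntax)
open import Data.Sum using (_⊎_)
open import Relation.Binary.PropositionalEquality using (_≡_; _≢_)
import Relation.Nullary

IsEven IsOdd : ℕ → Set
IsEven m = m % 2 ≡ 0
IsOdd  m = m % 2 ≡ 1

IsPartition : ℕ → List ℕ → Set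
IsPartition n λ′ = Linked _≥_ λ′ × All (λ m → m > 0) λ′ × sum λ′ ≡ n

ℓev : List ℕ → ℕ
ℓev λ′ = length (filter (λ m → m % 2 ≟ 0) λ′)

sumOddℓev : List (List ℕ) → ℕ
sumOddℓev L = sum (map ℓev (filter (λ μ → ℓev μ % 2 ≟ 1) L))

sumEvenℓev : List (List ℕ) → ℕ
sumEvenℓev L = sum (map ℓev (filter (λ μ → ℓev μ % 2 ≟ 0) L))

-- λ_j (1-based index j = i+1), with λ_j = 0 past the number of parts
part : List ℕ → ℕ → ℕ
part []        _       = 0
part (x ∷ _)   zero    = x
part (_ ∷ xs)  (suc i) = part xs i

-- μ(2k) for k ≥ 2 (a = 2k, a/2 = k)
μ : ℕ → List ℕ
μ k with k % 2 ≟ 0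
... | Relation.Nullary.yes _ = (k + 1) ∷ (k ∸ 1) ∷ []
... | Relation.Nullary.no  _ = (k + 2) ∷ (k ∸ 2) ∷ []

DistinctOddPartition : List ℕ → Set
DistinctOddPartition λo = Linked _>_ λo × All IsOdd λo

Special : ℕ → List ℕ → Set
Special n λ′ =
  IsPartition n λ′ ×
  ∃[ k ] ∃[ b ] ∃[ λo ]
    ( k ≥ 1
    × IsOdd b
    × DistinctOddPartition λo
    × λ′ ↭ (λo ++ replicate b (2 * k))
    × part λo 0 ∸ part λo 1 ≤ 2 * k
    × (k ≥ 2 → λo ≢ μ k)
    × (IsEven k → b ≡ 1 → λo ≢ []) )

-- A partition with one occurrence of an even part singled out is counted with sign
-- (-1)^(ℓ_ev(λ) + 1); summing over the ℓ_ev(λ) choices of the occurrence, the left-hand side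
-- becomes the signed number of such marked partitions of n.  A sign-reversing involution pairs
-- off all marked partitions except those of the right-hand side, which all have sign +1.  If the
-- unmarked parts are not distinct and odd, take the least y such that y is repeated or 2y has odd
-- multiplicity among them and apply Glaisher's move at y (split one 2y into y + y, or merge y + y
-- into 2y): this changes ℓ_ev by ±1.  Otherwise one copy of the marked part 2k is moved into or
-- out of the largest unmarked part (or turned into the two parts of μ(2k), or (2)^b is traded for
-- (2b)^1), which changes the number of copies of 2k by ±1.

module Submission where

open import Data.Nat using (ℕ; zero; suc; _+_; _*_; _∸_; _≤_; _<_; _≥_; _>_; _%_; z≤n; s≤s)
open import Data.Nat.Properties
open import Data.Nat.DivMod using (_/_; m*n%n≡0; [m+kn]%n≡m%n; m≡m%n+[m/n]*n; m*n/n≡m)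
open import Data.Nat.ListAction using (sum)
open import Data.Nat.ListAction.Properties using (sum-↭; sum-++)
open import Data.Nat.Tactic.RingSolver using (solve-∀)
open import Data.Integer using (ℤ; +_; _-_; -_; 0ℤ; 1ℤ; -1ℤ)
import Data.Integer as ℤ
import Data.Integer.Properties as ℤP
import Data.Integer.Tactic.RingSolver as ℤ-Solver
open import Data.Maybe using (Maybe; just; nothing; fromMaybe)
open import Data.Product using (∃-syntax; _×_; _,_; proj₁; proj₂; uncurry)
open import Data.Product.Properties using () renaming (≡-dec to ×-≡-dec)
open import Data.Sum using (_⊎_; inj₁; inj₂)
open import Data.List using (List; []; _∷_; length; filter; map; replicate; _++_; foldr; concatMap)
open import Data.List.Properties
  using (≡-dec; map-∘; length-map; filter-accept; filter-reject; filter-some; filter-none)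
open import Data.List.Membership.Propositional using (_∈_; find; lose)
open import Data.List.Membership.Propositional.Properties
  using (∈-filter⁻; ∈-filter⁺; ∈-map⁻; ∈-map⁺; ∈-concatMap⁻; ∈-concatMap⁺)
open import Data.List.Membership.Propositional.Properties.WithK using (unique∧set⇒bag)
open import Data.List.Relation.Binary.BagAndSetEquality using (∼bag⇒↭)
open import Data.List.Relation.Binary.Permutation.Propositional
  using (_↭_; ↭-refl; ↭-sym; ↭-trans; prep; swap; ↭⇒↭ₛ)
open import Data.List.Relation.Binary.Permutation.Propositional.Properties
  using (shift; drop-∷; filter-↭; ↭-length; All-resp-↭; ∈-resp-↭; ++⁺ˡ; map⁺; ++-comm)
import Data.List.Relation.Binary.Permutation.Homogeneous as Homogeneous
open import Data.List.Relation.Binary.Permutation.Setoid.Properties using (foldr-commMonoid)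
open import Data.List.Relation.Binary.Pointwise using (Pointwise-≡⇒≡)
import Data.List.Relation.Binary.Pointwise as Pointwise
open import Data.List.Relation.Unary.All as All using (All; []; _∷_)
import Data.List.Relation.Unary.All.Properties as AllP
open import Data.List.Relation.Unary.AllPairs using (AllPairs; []; _∷_)
open import Data.List.Relation.Unary.Any as Any using (here; there)
open import Data.List.Relation.Unary.Linked as Linked using (Linked; []; [-]; _∷_)
open import Data.List.Relation.Unary.Linked.Properties using (AllPairs⇒Linked; Linked⇒AllPairs)
import Data.List.Relation.Unary.Sorted.TotalOrder.Properties as SortedProperties
open import Data.List.Relation.Unary.Unique.Propositional using (Unique)
import Data.List.Relation.Unary.Unique.Propositional.Properties as Unique
open import Algebra.Bundles using (CommutativeMonoid)
open import Function using (_∘′_)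
open import Function.Bundles using (mk⇔)
open import Level using (0ℓ)
open import Relation.Nullary using (Dec; yes; no; ¬_; contradiction)
open import Relation.Nullary.Decidable using (_×-dec_)
open import Relation.Unary using (Decidable)
open import Relation.Unary.Properties using (∁?)
open import Relation.Binary.Bundles using (DecTotalOrder)
open import Relation.Binary.Definitions using (DecidableEquality)
import Relation.Binary.Construct.Flip.Ord as Flip
open import Relation.Binary.PropositionalEquality

open import Defs

≥-decTotalOrder : DecTotalOrder 0ℓ 0ℓ 0ℓ
≥-decTotalOrder = Flip.decTotalOrder ≤-decTotalOrder

open import Data.List.Sort.InsertionSort.Base ≥-decTotalOrder using (insert)
open import Data.List.Sort.InsertionSort.Properties ≥-decTotalOrder using (insert-↭; insert-↗)

Sorted : List ℕ → Set
Sorted = Linked _≥_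

sorted-↭⇒≡ : ∀ {xs ys} → Sorted xs → Sorted ys → xs ↭ ys → xs ≡ ys
sorted-↭⇒≡ xs↗ ys↗ p =
  Pointwise-≡⇒≡ (Pointwise.map sym
    (SortedProperties.↗↭↗⇒≋ (Flip.totalOrder ≤-totalOrder) xs↗ ys↗
      (Homogeneous.map sym (↭⇒↭ₛ p))))

insertAll : List ℕ → List ℕ → List ℕ
insertAll xs ys = foldr insert ys xs

insertAll-↭ : ∀ xs ys → insertAll xs ys ↭ xs ++ ys
insertAll-↭ []       ys = ↭-refl
insertAll-↭ (x ∷ xs) ys = ↭-trans (insert-↭ x (insertAll xs ys)) (prep x (insertAll-↭ xs ys))

insertAll-sorted : ∀ xs {ys} → Sorted ys → Sorted (insertAll xs ys)
insertAll-sorted []       ys↗ = ys↗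
insertAll-sorted (x ∷ xs) ys↗ = insert-↗ x (insertAll-sorted xs ys↗)

remove1 : ℕ → List ℕ → List ℕ
remove1 x []       = []
remove1 x (y ∷ ys) with y ≟ x
... | yes _ = ys
... | no  _ = y ∷ remove1 x ys

remove1-↭ : ∀ {x xs} → x ∈ xs → xs ↭ x ∷ remove1 x xs
remove1-↭ {x} {y ∷ ys} x∈ with y ≟ x | x∈
... | yes refl | _         = ↭-refl
... | no  y≢x  | here x≡y  = contradiction (sym x≡y) y≢x
... | no  _    | there x∈ys = ↭-trans (prep y (remove1-↭ x∈ys)) (swap y x ↭-refl)

remove1-⊆ : ∀ {x z} xs → z ∈ remove1 x xs → z ∈ xs
remove1-⊆ {x} (y ∷ ys) z∈ with y ≟ x
... | yes _ = there z∈
remove1-⊆ (y ∷ ys) (here z≡y)   | no _ = here z≡y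
remove1-⊆ (y ∷ ys) (there z∈ys) | no _ = there (remove1-⊆ ys z∈ys)

remove1-sorted : ∀ x {xs} → Sorted xs → Sorted (remove1 x xs)
remove1-sorted x = AllPairs⇒Linked ∘′ allPairs ∘′ Linked⇒AllPairs ≥-trans
  where
  ≥-trans : ∀ {a b c} → a ≥ b → b ≥ c → a ≥ c
  ≥-trans a≥b b≥c = ≤-trans b≥c a≥b
  allPairs : ∀ {xs} → AllPairs _≥_ xs → AllPairs _≥_ (remove1 x xs)
  allPairs {[]}     []           = []
  allPairs {y ∷ ys} (y≥ys ∷ ys↗) with y ≟ x
  ... | yes _ = ys↗
  ... | no  _ = All.tabulate (All.lookup y≥ys ∘′ remove1-⊆ ys) ∷ allPairs ys↗

remove1-∷ : ∀ {x xs ys} → xs ↭ x ∷ ys → remove1 x xs ↭ ys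
remove1-∷ p = drop-∷ (↭-trans (↭-sym (remove1-↭ (∈-resp-↭ (↭-sym p) (here refl)))) p)

removeAll : List ℕ → List ℕ → List ℕ
removeAll xs ys = foldr remove1 ys xs

removeAll-↭ : ∀ xs {ys zs} → ys ↭ xs ++ zs → removeAll xs ys ↭ zs
removeAll-↭ []       p = p
removeAll-↭ (x ∷ xs) {zs = zs} p = remove1-∷ (removeAll-↭ xs (↭-trans p (↭-sym (shift x xs zs))))

removeAll-sorted : ∀ xs {ys} → Sorted ys → Sorted (removeAll xs ys)
removeAll-sorted []       ys↗ = ys↗
removeAll-sorted (x ∷ xs) ys↗ = remove1-sorted x (removeAll-sorted xs ys↗)

removeAll-insertAll : ∀ xs {ys} → Sorted ys → removeAll xs (insertAll xs ys) ≡ ys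
removeAll-insertAll xs {ys} ys↗ =
  sorted-↭⇒≡ (removeAll-sorted xs (insertAll-sorted xs ys↗)) ys↗ (removeAll-↭ xs (insertAll-↭ xs ys))

insertAll-removeAll : ∀ xs {ys zs} → Sorted ys → ys ↭ xs ++ zs → insertAll xs (removeAll xs ys) ≡ ys
insertAll-removeAll xs {ys} ys↗ p = sorted-↭⇒≡ (insertAll-sorted xs (removeAll-sorted xs ys↗)) ys↗
  (↭-trans (insertAll-↭ xs (removeAll xs ys)) (↭-trans (++⁺ˡ xs (removeAll-↭ xs p)) (↭-sym p)))

exchange : List ℕ → List ℕ → List ℕ → List ℕ
exchange old new xs = insertAll new (removeAll old xs)

exchange-↭ : ∀ old new {xs ys} → xs ↭ old ++ ys → exchange old new xs ↭ new ++ ys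
exchange-↭ old new {xs} p = ↭-trans (insertAll-↭ new (removeAll old xs)) (++⁺ˡ new (removeAll-↭ old p))

exchange-sorted : ∀ old new {xs} → Sorted xs → Sorted (exchange old new xs)
exchange-sorted old new xs↗ = insertAll-sorted new (removeAll-sorted old xs↗)

exchange-involutive : ∀ old new {xs ys} → Sorted xs → xs ↭ old ++ ys →
                      exchange new old (exchange old new xs) ≡ xs
exchange-involutive old new {xs} xs↗ p = begin
  insertAll old (removeAll new (insertAll new (removeAll old xs)))
    ≡⟨ cong (insertAll old) (removeAll-insertAll new (removeAll-sorted old xs↗)) ⟩
  insertAll old (removeAll old xs)
    ≡⟨ insertAll-removeAll old xs↗ p ⟩
  xs ∎
  where open ≡-Reasoning

count : ℕ → List ℕ → ℕ
count x xs = length (filter (_≟ x) xs)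

count-↭ : ∀ x {xs ys} → xs ↭ ys → count x xs ≡ count x ys
count-↭ x p = ↭-length (filter-↭ (_≟ x) p)

count-∷-≡ : ∀ x xs → count x (x ∷ xs) ≡ suc (count x xs)
count-∷-≡ x xs = cong length (filter-accept (_≟ x) {x} {xs} refl)

count-∷-≢ : ∀ {x y} xs → y ≢ x → count x (y ∷ xs) ≡ count x xs
count-∷-≢ {x} {y} xs y≢x = cong length (filter-reject (_≟ x) {y} {xs} y≢x)

count-∷-≤ : ∀ x y xs → count x xs ≤ count x (y ∷ xs)
count-∷-≤ x y xs with y ≟ x
... | yes refl = ≤-trans (n≤1+n (count y xs)) (≤-reflexive (sym (count-∷-≡ y xs)))
... | no  y≢x  = ≤-reflexive (sym (count-∷-≢ xs y≢x))

count≥1⇒∈ : ∀ x xs → 1 ≤ count x xs → x ∈ xs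
count≥1⇒∈ x (y ∷ ys) c≥1 with y ≟ x
... | yes refl = here refl
... | no  y≢x  = there (count≥1⇒∈ x ys (≤-trans c≥1 (≤-reflexive (count-∷-≢ ys y≢x))))

∈⇒count≥1 : ∀ {x xs} → x ∈ xs → 1 ≤ count x xs
∈⇒count≥1 {x} x∈ = filter-some (_≟ x) (Any.map sym x∈)

↭-replicate-++ : ∀ j x xs → j ≤ count x xs → ∃[ ys ] xs ↭ replicate j x ++ ys
↭-replicate-++ zero    x xs       _ = xs , ↭-refl
↭-replicate-++ (suc j) x []       ()
↭-replicate-++ (suc j) x (y ∷ ys) j<c with y ≟ x
... | yes refl =
  let zs , p = ↭-replicate-++ j x ys (≤-pred (≤-trans j<c (≤-reflexive (count-∷-≡ y ys))))
  in zs , prep y p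
... | no y≢x =
  let zs , p = ↭-replicate-++ (suc j) x ys (≤-trans j<c (≤-reflexive (count-∷-≢ ys y≢x)))
  in y ∷ zs , ↭-trans (prep y p) (↭-sym (shift y (replicate (suc j) x) zs))

∈⇒≤sum : ∀ {x xs} → x ∈ xs → x ≤ sum xs
∈⇒≤sum {xs = y ∷ ys} (here refl)  = m≤m+n y (sum ys)
∈⇒≤sum {xs = y ∷ ys} (there x∈ys) = ≤-trans (∈⇒≤sum x∈ys) (m≤n+m (sum ys) y)

sum-replicate : ∀ b x → sum (replicate b x) ≡ b * x
sum-replicate zero    x = refl
sum-replicate (suc b) x = cong (λ s → x + s) (sum-replicate b x)

sum-replicate-++ : ∀ b x ys → sum (replicate b x ++ ys) ≡ sum ys + b * x
sum-replicate-++ b x ys =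
  trans (sum-++ (replicate b x) ys) (trans (cong (_+ sum ys) (sum-replicate b x)) (+-comm (b * x) (sum ys)))

count-replicate-++ : ∀ b x ys → count x (replicate b x ++ ys) ≡ b + count x ys
count-replicate-++ zero    x ys = refl
count-replicate-++ (suc b) x ys = trans (count-∷-≡ x _) (cong suc (count-replicate-++ b x ys))

count-replicate-++-≢ : ∀ b {x y} ys → y ≢ x → count x (replicate b y ++ ys) ≡ count x ys
count-replicate-++-≢ zero    ys y≢x = refl
count-replicate-++-≢ (suc b) ys y≢x = trans (count-∷-≢ _ y≢x) (count-replicate-++-≢ b ys y≢x)

parity : ∀ n → IsEven n ⊎ IsOdd n
parity zero          = inj₁ refl
parity (suc zero)    = inj₂ refl
parity (suc (suc n)) = parity n

even⇒¬odd : ∀ n → IsEven n → ¬ IsOdd n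
even⇒¬odd _ even odd with () ← trans (sym even) odd

even-suc : ∀ n → IsOdd n → IsEven (suc n)
even-suc (suc zero)    _   = refl
even-suc (suc (suc n)) odd = even-suc n odd

odd-suc : ∀ n → IsEven n → IsOdd (suc n)
odd-suc zero          _    = refl
odd-suc (suc (suc n)) even = odd-suc n even

¬odd⇒even : ∀ n → ¬ IsOdd n → IsEven n
¬odd⇒even n ¬odd with parity n
... | inj₁ even = even
... | inj₂ odd  = contradiction odd ¬odd

¬even⇒odd : ∀ n → ¬ IsEven n → IsOdd n
¬even⇒odd n ¬even with parity n
... | inj₁ even = contradiction even ¬even
... | inj₂ odd  = odd

even-pred : ∀ n → IsOdd (suc n) → IsEven n
even-pred zero          _   = refl
even-pred (suc (suc n)) odd = even-pred n odd

odd-pred : ∀ n → IsEven (suc n) → IsOdd n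
odd-pred (suc zero)    _    = refl
odd-pred (suc (suc n)) even = odd-pred n even

odd⇒≥1 : ∀ {n} → IsOdd n → n ≥ 1
odd⇒≥1 {suc n} _ = s≤s z≤n

even-2* : ∀ k → IsEven (2 * k)
even-2* k = trans (cong (_% 2) (*-comm 2 k)) (m*n%n≡0 k 2)

+-2*-parity : ∀ m k → (m + 2 * k) % 2 ≡ m % 2
+-2*-parity m k = trans (cong (λ t → (m + t) % 2) (*-comm 2 k)) ([m+kn]%n≡m%n m k 2)

half-even : ∀ x → IsEven x → 2 * (x / 2) ≡ x
half-even x even = begin
  2 * (x / 2)         ≡⟨ *-comm 2 (x / 2) ⟩
  x / 2 * 2           ≡⟨ cong (_+ x / 2 * 2) even ⟨
  x % 2 + x / 2 * 2   ≡⟨ m≡m%n+[m/n]*n x 2 ⟨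
  x                   ∎
  where open ≡-Reasoning

half-2* : ∀ k → (2 * k) / 2 ≡ k
half-2* k = trans (cong (_/ 2) (*-comm 2 k)) (m*n/n≡m k 2)

positive-half : ∀ y → 2 * y > 0 → y ≥ 1
positive-half (suc y) _ = s≤s z≤n

count-even-in-odd≡0 : ∀ k {o} → All IsOdd o → count (2 * k) o ≡ 0
count-even-in-odd≡0 k odds = cong length (filter-none (_≟ 2 * k) (All.map odd≢2k odds))
  where
  odd≢2k : ∀ {x} → IsOdd x → x ≢ 2 * k
  odd≢2k odd refl = even⇒¬odd (2 * k) (even-2* k) odd

sign : ℕ → ℤ
sign zero    = 1ℤ
sign (suc n) = - sign n

sign-even : ∀ n → IsEven n → sign n ≡ 1ℤ
sign-even zero          _    = refl
sign-even (suc (suc n)) even = trans (ℤP.neg-involutive (sign n)) (sign-even n even)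

sign-odd : ∀ n → IsOdd n → sign n ≡ -1ℤ
sign-odd (suc zero)    _   = refl
sign-odd (suc (suc n)) odd = trans (ℤP.neg-involutive (sign n)) (sign-odd n odd)

ℓev-↭ : ∀ {xs ys} → xs ↭ ys → ℓev xs ≡ ℓev ys
ℓev-↭ p = ↭-length (filter-↭ (λ m → m % 2 ≟ 0) p)

ℓev-∷-even : ∀ x xs → IsEven x → ℓev (x ∷ xs) ≡ suc (ℓev xs)
ℓev-∷-even x xs even = cong length (filter-accept (λ m → m % 2 ≟ 0) {x} {xs} even)

ℓev-∷-odd : ∀ x xs → IsOdd x → ℓev (x ∷ xs) ≡ ℓev xs
ℓev-∷-odd x xs odd =
  cong length (filter-reject (λ m → m % 2 ≟ 0) {x} {xs} (λ even → even⇒¬odd x even odd))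

ℓev-odd : ∀ {xs} → All IsOdd xs → ℓev xs ≡ 0
ℓev-odd []         = refl
ℓev-odd {x ∷ xs} (odd ∷ os) = trans (ℓev-∷-odd x xs odd) (ℓev-odd os)

ℓev-replicate-++ : ∀ j k ys → ℓev (replicate j (2 * k) ++ ys) ≡ j + ℓev ys
ℓev-replicate-++ zero    k ys = refl
ℓev-replicate-++ (suc j) k ys = trans (ℓev-∷-even (2 * k) _ (even-2* k)) (cong suc (ℓev-replicate-++ j k ys))

-- Glaisher's move

y≢2y : ∀ {y} → y ≥ 1 → y ≢ 2 * y
y≢2y {y} y≥1 = <⇒≢ (m<m+n y (≤-trans y≥1 (≤-reflexive (sym (+-identityʳ y)))))

n≢2+n : ∀ {n} → n ≢ 2 + n
n≢2+n {n} = <⇒≢ (m<n+m n (s≤s z≤n))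

record Splits (y : ℕ) (l g : List ℕ) : Set where
  constructor splitting
  field
    rest   : List ℕ
    before : l ↭ 2 * y ∷ rest
    after  : g ↭ y ∷ y ∷ rest

Related : ℕ → List ℕ → List ℕ → Set
Related y l g = Splits y l g ⊎ Splits y g l

splits-count : ∀ {y l g z} → Splits y l g → y ≢ z → 2 * y ≢ z → count z g ≡ count z l
splits-count {y} {l} {g} {z} (splitting r l↭ g↭) y≢z 2y≢z = begin
  count z g           ≡⟨ count-↭ z g↭ ⟩
  count z (y ∷ y ∷ r) ≡⟨ count-∷-≢ (y ∷ r) y≢z ⟩
  count z (y ∷ r)     ≡⟨ count-∷-≢ r y≢z ⟩
  count z r           ≡⟨ count-∷-≢ r 2y≢z ⟨
  count z (2 * y ∷ r) ≡⟨ count-↭ z l↭ ⟨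
  count z l           ∎
  where open ≡-Reasoning

splits-count-y : ∀ {y l g} → y ≥ 1 → Splits y l g → count y g ≡ 2 + count y l
splits-count-y {y} {l} {g} y≥1 (splitting r l↭ g↭) = begin
  count y g           ≡⟨ count-↭ y g↭ ⟩
  count y (y ∷ y ∷ r) ≡⟨ count-∷-≡ y (y ∷ r) ⟩
  suc (count y (y ∷ r)) ≡⟨ cong suc (count-∷-≡ y r) ⟩
  2 + count y r       ≡⟨ cong (λ c → 2 + c) (count-∷-≢ r (y≢2y y≥1 ∘′ sym)) ⟨
  2 + count y (2 * y ∷ r) ≡⟨ cong (λ c → 2 + c) (count-↭ y l↭) ⟨
  2 + count y l       ∎
  where open ≡-Reasoning

splits-count-2y : ∀ {y l g} → y ≥ 1 → Splits y l g → count (2 * y) l ≡ suc (count (2 * y) g)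
splits-count-2y {y} {l} {g} y≥1 (splitting r l↭ g↭) = begin
  count (2 * y) l           ≡⟨ count-↭ (2 * y) l↭ ⟩
  count (2 * y) (2 * y ∷ r) ≡⟨ count-∷-≡ (2 * y) r ⟩
  suc (count (2 * y) r)     ≡⟨ cong suc (count-∷-≢ r (y≢2y y≥1)) ⟨
  suc (count (2 * y) (y ∷ r)) ≡⟨ cong suc (count-∷-≢ (y ∷ r) (y≢2y y≥1)) ⟨
  suc (count (2 * y) (y ∷ y ∷ r)) ≡⟨ cong suc (count-↭ (2 * y) g↭) ⟨
  suc (count (2 * y) g)     ∎
  where open ≡-Reasoning

splits-sum : ∀ {y l g} → Splits y l g → sum g ≡ sum l
splits-sum {y} {l} {g} (splitting r l↭ g↭) = begin
  sum g               ≡⟨ sum-↭ g↭ ⟩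
  y + (y + sum r)     ≡⟨ +-assoc y y (sum r) ⟨
  y + y + sum r       ≡⟨ cong (λ t → y + t + sum r) (+-identityʳ y) ⟨
  2 * y + sum r       ≡⟨ sum-↭ l↭ ⟨
  sum l               ∎
  where open ≡-Reasoning

ℓev-∷∷ : ∀ y r → ℓev (y ∷ y ∷ r) ≡ ℓev r ⊎ ℓev (y ∷ y ∷ r) ≡ 2 + ℓev r
ℓev-∷∷ y r with parity y
... | inj₁ even = inj₂ (trans (ℓev-∷-even y (y ∷ r) even) (cong suc (ℓev-∷-even y r even)))
... | inj₂ odd  = inj₁ (trans (ℓev-∷-odd y (y ∷ r) odd) (ℓev-∷-odd y r odd))

splits-sign : ∀ {y l g} s → Splits y l g → sign (ℓev g + s) ≡ - sign (ℓev l + s)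
splits-sign {y} {l} {g} s (splitting r l↭ g↭) = begin
  sign (ℓev g + s)                 ≡⟨ cong (λ t → sign (t + s)) (ℓev-↭ g↭) ⟩
  sign (ℓev (y ∷ y ∷ r) + s)       ≡⟨ pair-invisible (ℓev-∷∷ y r) ⟩
  sign (ℓev r + s)                 ≡⟨ ℤP.neg-involutive _ ⟨
  - sign (suc (ℓev r) + s)         ≡⟨ cong (λ t → - sign (t + s)) (ℓev-∷-even (2 * y) r (even-2* y)) ⟨
  - sign (ℓev (2 * y ∷ r) + s)     ≡⟨ cong (λ t → - sign (t + s)) (ℓev-↭ l↭) ⟨
  - sign (ℓev l + s)               ∎
  where
  open ≡-Reasoning
  pair-invisible : ∀ {m} → m ≡ ℓev r ⊎ m ≡ 2 + ℓev r → sign (m + s) ≡ sign (ℓev r + s)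
  pair-invisible (inj₁ refl) = refl
  pair-invisible (inj₂ refl) = ℤP.neg-involutive _

splits-positive : ∀ {y l g} → y ≥ 1 → Splits y l g → All (_> 0) l → All (_> 0) g
splits-positive y≥1 (splitting r l↭ g↭) l>0 with All-resp-↭ l↭ l>0
... | _ ∷ r>0 = All-resp-↭ (↭-sym g↭) (y≥1 ∷ y≥1 ∷ r>0)

splits-positive⁻ : ∀ {y l g} → y ≥ 1 → Splits y l g → All (_> 0) g → All (_> 0) l
splits-positive⁻ {y} y≥1 (splitting r l↭ g↭) g>0 with All-resp-↭ g↭ g>0
... | _ ∷ _ ∷ r>0 = All-resp-↭ (↭-sym l↭) (≤-trans y≥1 (m≤m+n y (y + 0)) ∷ r>0)

related-count : ∀ {y l g z} → Related y l g → y ≢ z → 2 * y ≢ z → count z g ≡ count z l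
related-count (inj₁ s) y≢z 2y≢z = splits-count s y≢z 2y≢z
related-count (inj₂ s) y≢z 2y≢z = sym (splits-count s y≢z 2y≢z)

related-count-y : ∀ {y l g} → y ≥ 1 → Related y l g → count y g % 2 ≡ count y l % 2
related-count-y y≥1 (inj₁ s) = cong (_% 2) (splits-count-y y≥1 s)
related-count-y y≥1 (inj₂ s) = cong (_% 2) (sym (splits-count-y y≥1 s))

related-sum : ∀ {y l g} → Related y l g → sum g ≡ sum l
related-sum (inj₁ s) = splits-sum s
related-sum (inj₂ s) = sym (splits-sum s)

related-sign : ∀ {y l g} s → Related y l g → sign (ℓev g + s) ≡ - sign (ℓev l + s)
related-sign s (inj₁ sp) = splits-sign s sp
related-sign s (inj₂ sp) = trans (sym (ℤP.neg-involutive _)) (cong -_ (sym (splits-sign s sp)))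

related-positive : ∀ {y l g} → y ≥ 1 → Related y l g → All (_> 0) l → All (_> 0) g
related-positive y≥1 (inj₁ s) = splits-positive y≥1 s
related-positive y≥1 (inj₂ s) = splits-positive⁻ y≥1 s

data Active (l : List ℕ) (y : ℕ) : Set where
  odd-double : IsOdd (count (2 * y) l) → Active l y
  repeated   : 2 ≤ count y l → Active l y

active? : ∀ l y → Dec (Active l y)
active? l y with count (2 * y) l % 2 ≟ 1 | 2 ≤? count y l
... | yes odd  | _        = yes (odd-double odd)
... | no  _    | yes c≥2  = yes (repeated c≥2)
... | no  ¬odd | no  c≱2  = no λ { (odd-double odd) → ¬odd odd ; (repeated c≥2) → c≱2 c≥2 }

related-active-below : ∀ {y l g z} → y ≥ 1 → Related y l g → z < y → Active g z → Active l z
related-active-below {y} {l} {g} {z} y≥1 rel z<y (odd-double odd) = odd-double (trans (sym same-parity) odd)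
  where
  y≢z : y ≢ z
  y≢z = ≢-sym (<⇒≢ z<y)
  same-parity : count (2 * z) g % 2 ≡ count (2 * z) l % 2
  same-parity with y ≟ 2 * z
  ... | yes refl = related-count-y y≥1 rel
  ... | no y≢2z  = cong (_% 2) (related-count rel y≢2z (y≢z ∘′ *-cancelˡ-≡ y z 2))
related-active-below {y} y≥1 rel z<y (repeated c≥2) =
  repeated (≤-trans c≥2 (≤-reflexive (related-count rel (≢-sym (<⇒≢ z<y))
                                    (≢-sym (<⇒≢ (<-≤-trans z<y (m≤m+n y (y + 0))))))))

split merge : ℕ → List ℕ → List ℕ
split y = exchange (2 * y ∷ []) (y ∷ y ∷ [])
merge y = exchange (y ∷ y ∷ []) (2 * y ∷ [])

-- Choosing the direction by the parity of the multiplicity of 2y makes the move an involution.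
glaisher : ℕ → List ℕ → List ℕ
glaisher y l with count (2 * y) l % 2 ≟ 1
... | yes _ = split y l
... | no  _ = merge y l

glaisher-odd : ∀ y l → IsOdd (count (2 * y) l) → glaisher y l ≡ split y l
glaisher-odd y l odd with count (2 * y) l % 2 ≟ 1
... | yes _   = refl
... | no ¬odd = contradiction odd ¬odd

glaisher-even : ∀ y l → ¬ IsOdd (count (2 * y) l) → glaisher y l ≡ merge y l
glaisher-even y l ¬odd with count (2 * y) l % 2 ≟ 1
... | yes odd = contradiction odd ¬odd
... | no _    = refl

odd-double⇒↭ : ∀ y l → IsOdd (count (2 * y) l) → ∃[ r ] l ↭ (2 * y ∷ []) ++ r
odd-double⇒↭ y l odd = ↭-replicate-++ 1 (2 * y) l (odd⇒≥1 odd)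

repeated⇒↭ : ∀ y l → 2 ≤ count y l → ∃[ r ] l ↭ (y ∷ y ∷ []) ++ r
repeated⇒↭ y l = ↭-replicate-++ 2 y l

split-splits : ∀ y l → IsOdd (count (2 * y) l) → Splits y l (split y l)
split-splits y l odd with odd-double⇒↭ y l odd
... | r , l↭ = splitting r l↭ (exchange-↭ (2 * y ∷ []) (y ∷ y ∷ []) l↭)

merge-splits : ∀ y l → 2 ≤ count y l → Splits y (merge y l) l
merge-splits y l c≥2 with repeated⇒↭ y l c≥2
... | r , l↭ = splitting r (exchange-↭ (y ∷ y ∷ []) (2 * y ∷ []) l↭) l↭

active-even⇒≥2 : ∀ {l y} → Active l y → ¬ IsOdd (count (2 * y) l) → 2 ≤ count y l
active-even⇒≥2 (odd-double odd) ¬odd = contradiction odd ¬odd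
active-even⇒≥2 (repeated c≥2)   _    = c≥2

glaisher-related : ∀ {y l} → Active l y → Related y l (glaisher y l)
glaisher-related {y} {l} act with count (2 * y) l % 2 ≟ 1
... | yes odd  = inj₁ (split-splits y l odd)
... | no  ¬odd = inj₂ (merge-splits y l (active-even⇒≥2 act ¬odd))

glaisher-sorted : ∀ y {l} → Sorted l → Sorted (glaisher y l)
glaisher-sorted y {l} l↗ with count (2 * y) l % 2 ≟ 1
... | yes _ = exchange-sorted (2 * y ∷ []) (y ∷ y ∷ []) l↗
... | no  _ = exchange-sorted (y ∷ y ∷ []) (2 * y ∷ []) l↗

glaisher-active : ∀ {y l} → y ≥ 1 → Active l y → Active (glaisher y l) y
glaisher-active {y} {l} y≥1 act with count (2 * y) l % 2 ≟ 1
... | yes odd  = repeated (≤-trans (m≤m+n 2 (count y l)) (≤-reflexive (sym (splits-count-y y≥1 (split-splits y l odd)))))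
... | no  ¬odd = odd-double (subst IsOdd (sym (splits-count-2y y≥1 (merge-splits y l (active-even⇒≥2 act ¬odd))))
                              (odd-suc (count (2 * y) l) (¬odd⇒even (count (2 * y) l) ¬odd)))

glaisher-involutive : ∀ {y l} → y ≥ 1 → Sorted l → Active l y → glaisher y (glaisher y l) ≡ l
glaisher-involutive {y} {l} y≥1 l↗ act with count (2 * y) l % 2 ≟ 1
... | yes odd = begin
  glaisher y (split y l) ≡⟨ glaisher-even y (split y l) (even⇒¬odd (count (2 * y) (split y l)) split-even) ⟩
  merge y (split y l)    ≡⟨ exchange-involutive (2 * y ∷ []) (y ∷ y ∷ []) l↗
                                                (proj₂ (odd-double⇒↭ y l odd)) ⟩
  l                      ∎
  where
  open ≡-Reasoning
  split-even : IsEven (count (2 * y) (split y l))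
  split-even = even-pred (count (2 * y) (split y l)) (subst IsOdd (splits-count-2y y≥1 (split-splits y l odd)) odd)
... | no ¬odd = begin
  glaisher y (merge y l) ≡⟨ glaisher-odd y (merge y l) merge-odd ⟩
  split y (merge y l)    ≡⟨ exchange-involutive (y ∷ y ∷ []) (2 * y ∷ []) l↗
                                                (proj₂ (repeated⇒↭ y l c≥2)) ⟩
  l                      ∎
  where
  open ≡-Reasoning
  c≥2 = active-even⇒≥2 act ¬odd
  merge-odd : IsOdd (count (2 * y) (merge y l))
  merge-odd = subst IsOdd (sym (splits-count-2y y≥1 (merge-splits y l c≥2)))
                     (odd-suc (count (2 * y) l) (¬odd⇒even (count (2 * y) l) ¬odd))

glaisher-≢ : ∀ {y l} → y ≥ 1 → Active l y → glaisher y l ≢ l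
glaisher-≢ {y} y≥1 act g≡l with glaisher-related act
... | inj₁ s = n≢2+n (trans (cong (count y) (sym g≡l)) (splits-count-y y≥1 s))
... | inj₂ s = n≢2+n (trans (cong (count y) g≡l) (splits-count-y y≥1 s))

IsLeastFrom : (ℕ → Set) → ℕ → ℕ → Set
IsLeastFrom P s y = P y × s ≤ y × (∀ z → s ≤ z → z < y → ¬ P z)

module _ {P : ℕ → Set} (P? : Decidable P) where

  firstFrom : ℕ → ℕ → Maybe ℕ
  firstFrom s zero    = nothing
  firstFrom s (suc f) with P? s
  ... | yes _ = just s
  ... | no  _ = firstFrom (suc s) f

  firstFrom-just : ∀ s f {y} → firstFrom s f ≡ just y → IsLeastFrom P s y
  firstFrom-just s (suc f) {y} eq with P? s
  firstFrom-just s (suc f) refl | yes Ps = Ps , ≤-refl , λ z s≤z z<s → contradiction s≤z (<⇒≱ z<s)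
  ... | no ¬Ps with firstFrom-just (suc s) f eq
  ...   | Py , s<y , below = Py , <⇒≤ s<y , below′
    where
    below′ : ∀ z → s ≤ z → z < y → ¬ P z
    below′ z s≤z z<y with s ≟ z
    ... | yes refl = ¬Ps
    ... | no  s≢z  = below z (≤∧≢⇒< s≤z s≢z) z<y

  firstFrom-nothing : ∀ s f → firstFrom s f ≡ nothing → ∀ z → s ≤ z → z < s + f → ¬ P z
  firstFrom-nothing s zero    _  z s≤z z<s+0 = contradiction s≤z (<⇒≱ (subst (z <_) (+-identityʳ s) z<s+0))
  firstFrom-nothing s (suc f) eq z s≤z z<s+f with P? s
  ... | no ¬Ps with s ≟ z
  ...   | yes refl = ¬Ps
  ...   | no  s≢z  = firstFrom-nothing (suc s) f eq z (≤∧≢⇒< s≤z s≢z) (subst (z <_) (+-suc s f) z<s+f)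

  firstFrom-least : ∀ s f {y} → IsLeastFrom P s y → y < s + f → firstFrom s f ≡ just y
  firstFrom-least s zero    (_ , s≤y , _) y<s+0 = contradiction s≤y (<⇒≱ (subst (_ <_) (+-identityʳ s) y<s+0))
  firstFrom-least s (suc f) {y} (Py , s≤y , below) y<s+f with P? s | s ≟ y
  ... | yes _   | yes refl = refl
  ... | yes Ps  | no  s≢y  = contradiction Ps (below s ≤-refl (≤∧≢⇒< s≤y s≢y))
  ... | no  ¬Ps | yes refl = contradiction Py ¬Ps
  ... | no  _   | no  s≢y  =
    firstFrom-least (suc s) f (Py , ≤∧≢⇒< s≤y s≢y , λ z s<z → below z (<⇒≤ s<z)) (subst (y <_) (+-suc s f) y<s+f)

  firstFrom-none : ∀ s f → (∀ z → ¬ P z) → firstFrom s f ≡ nothing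
  firstFrom-none s zero    _    = refl
  firstFrom-none s (suc f) none with P? s
  ... | yes Ps = contradiction Ps (none s)
  ... | no  _  = firstFrom-none (suc s) f none

strict⇒count≤1 : ∀ x {xs} → AllPairs _>_ xs → count x xs ≤ 1
strict⇒count≤1 x {[]}     []           = z≤n
strict⇒count≤1 x {y ∷ ys} (y>ys ∷ ys↘) with y ≟ x
... | yes refl =
  ≤-reflexive (trans (count-∷-≡ y ys) (cong (suc ∘′ length) (filter-none (_≟ y) (All.map <⇒≢ y>ys))))
... | no  y≢x  = ≤-trans (≤-reflexive (count-∷-≢ ys y≢x)) (strict⇒count≤1 x ys↘)

sorted-single⇒strict : ∀ {xs} → Sorted xs → (∀ {x} → x ∈ xs → count x xs ≤ 1) → Linked _>_ xs
sorted-single⇒strict []                   _      = []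
sorted-single⇒strict [-]                  _      = [-]
sorted-single⇒strict {x ∷ y ∷ ys} (x≥y ∷ y∷ys↗) single =
  ≤∧≢⇒< x≥y y≢x ∷
  sorted-single⇒strict y∷ys↗ (λ {z} z∈ → ≤-trans (count-∷-≤ z x (y ∷ ys)) (single (there z∈)))
  where
  y≢x : y ≢ x
  y≢x refl with ≤-trans (≤-reflexive (sym (trans (count-∷-≡ y (y ∷ ys)) (cong suc (count-∷-≡ y ys)))))
                        (single (here refl))
  ... | s≤s ()

distinctOdd⇒allPairs : ∀ {l} → DistinctOddPartition l → AllPairs _>_ l
distinctOdd⇒allPairs (l↘ , _) = Linked⇒AllPairs (λ a>b b>c → <-trans b>c a>b) l↘

distinctOdd-sorted : ∀ {l} → DistinctOddPartition l → Sorted l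
distinctOdd-sorted (l↘ , _) = Linked.map <⇒≤ l↘

distinctOdd-positive : ∀ {l} → DistinctOddPartition l → All (_> 0) l
distinctOdd-positive (_ , odds) = All.map odd⇒≥1 odds

distinctOdd-head : ∀ {d r} → DistinctOddPartition (d ∷ r) → part r 0 < d
distinctOdd-head {r = []}    (_ , odd ∷ _)      = odd⇒≥1 odd
distinctOdd-head {r = _ ∷ _} (d>e ∷ _ , _)      = d>e

distinctOdd-replaceHead : ∀ {d d′ r} → DistinctOddPartition (d ∷ r) → part r 0 < d′ → IsOdd d′ →
                          DistinctOddPartition (d′ ∷ r)
distinctOdd-replaceHead {r = []}    _                  _    odd = [-] , odd ∷ []
distinctOdd-replaceHead {r = _ ∷ _} (_ ∷ r↘ , _ ∷ odds) d′>e odd = d′>e ∷ r↘ , odd ∷ odds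

distinctOdd⇒inactive : ∀ {l y} → DistinctOddPartition l → ¬ Active l y
distinctOdd⇒inactive {l} {y} (_ , odds) (odd-double odd) =
  even⇒¬odd (2 * y) (even-2* y) (All.lookup odds (count≥1⇒∈ (2 * y) l (odd⇒≥1 odd)))
distinctOdd⇒inactive {y = y} dl (repeated c≥2) =
  contradiction (≤-trans c≥2 (strict⇒count≤1 y (distinctOdd⇒allPairs dl))) λ { (s≤s ()) }

inactive⇒distinctOdd : ∀ {l} → Sorted l → All (_> 0) l →
                       (∀ z → 1 ≤ z → z < 1 + sum l → ¬ Active l z) → DistinctOddPartition l
inactive⇒distinctOdd {l} l↗ l>0 inactive = sorted-single⇒strict l↗ single , All.tabulate odd
  where
  inactive∈ : ∀ {x} → x ∈ l → ¬ Active l x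
  inactive∈ x∈ = inactive _ (All.lookup l>0 x∈) (s≤s (∈⇒≤sum x∈))
  single : ∀ {x} → x ∈ l → count x l ≤ 1
  single x∈ = ≤-pred (≰⇒> (inactive∈ x∈ ∘′ repeated))
  odd : ∀ {x} → x ∈ l → IsOdd x
  odd {x} x∈ with parity x
  ... | inj₂ x-odd  = x-odd
  ... | inj₁ x-even = contradiction (odd-double once) (inactive y y≥1 (s≤s (≤-trans y≤x (∈⇒≤sum x∈))))
    where
    y = x / 2
    2y≡x : 2 * y ≡ x
    2y≡x = half-even x x-even
    y≥1 : y ≥ 1
    y≥1 = positive-half y (subst (_> 0) (sym 2y≡x) (All.lookup l>0 x∈))
    y≤x : y ≤ x
    y≤x = subst (y ≤_) 2y≡x (m≤m+n y (y + 0))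
    once : IsOdd (count (2 * y) l)
    once = cong (_% 2) (≤-antisym (single x∈′) (∈⇒count≥1 x∈′))
      where x∈′ = subst (_∈ l) (sym 2y≡x) x∈

active⇒≤sum : ∀ {l y} → y ≥ 1 → Active l y → y ≤ sum l
active⇒≤sum {l} {y} _ (odd-double odd) =
  ≤-trans (m≤m+n y (y + 0)) (∈⇒≤sum (count≥1⇒∈ (2 * y) l (odd⇒≥1 odd)))
active⇒≤sum {l} {y} _ (repeated c≥2)   = ∈⇒≤sum (count≥1⇒∈ y l (≤-trans (s≤s z≤n) c≥2))

leastActive : List ℕ → Maybe ℕ
leastActive l = firstFrom (active? l) 1 (sum l)

-- The partitions μ(2k)

balancedPair : ℕ → ℕ → List ℕ
balancedPair k j = (k + j) ∷ (k ∸ j) ∷ []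

μ≡balancedPair : ∀ k → ∃[ j ] 1 ≤ j × j ≤ 2 × IsOdd (k + j) × μ k ≡ balancedPair k j
μ≡balancedPair k with k % 2 ≟ 0
... | yes even = 1 , ≤-refl , s≤s z≤n , subst IsOdd (+-comm 1 k) (odd-suc k even) , refl
... | no  ¬even = 2 , s≤s z≤n , ≤-refl , trans (+-2*-parity k 1) (¬even⇒odd k ¬even) , refl

module _ {k j : ℕ} (j≥1 : j ≥ 1) (j≤k : j ≤ k) (odd : IsOdd (k + j)) where

  private
    k≡ : k ≡ k ∸ j + j
    k≡ = sym (m∸n+n≡m j≤k)

    k+j≡ : k + j ≡ k ∸ j + 2 * j
    k+j≡ = trans (cong (_+ j) k≡) (lemma (k ∸ j) j)
      where
      lemma : ∀ a j → a + j + j ≡ a + 2 * j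
      lemma = solve-∀

  balancedPair-distinctOdd : DistinctOddPartition (balancedPair k j)
  balancedPair-distinctOdd =
    (≤-trans (s≤s (m∸n≤m k j)) (m<m+n k j≥1) ∷ [-]) ,
    (odd ∷ trans (sym (+-2*-parity (k ∸ j) j)) (subst IsOdd k+j≡ odd) ∷ [])

  balancedPair-sum : sum (balancedPair k j) ≡ 2 * k
  balancedPair-sum = begin
    k + j + (k ∸ j + 0)           ≡⟨ cong (_+ (k ∸ j + 0)) k+j≡ ⟩
    k ∸ j + 2 * j + (k ∸ j + 0)   ≡⟨ lemma (k ∸ j) j ⟩
    2 * (k ∸ j + j)               ≡⟨ cong (2 *_) k≡ ⟨
    2 * k                         ∎
    where
    open ≡-Reasoning
    lemma : ∀ a j → a + 2 * j + (a + 0) ≡ 2 * (a + j)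
    lemma = solve-∀

  balancedPair-gap : (k + j) ∸ (k ∸ j) ≤ 2 * k
  balancedPair-gap = begin
    (k + j) ∸ (k ∸ j)             ≡⟨ cong (_∸ (k ∸ j)) k+j≡ ⟩
    (k ∸ j + 2 * j) ∸ (k ∸ j)     ≡⟨ m+n∸m≡n (k ∸ j) (2 * j) ⟩
    2 * j                         ≤⟨ *-monoʳ-≤ 2 j≤k ⟩
    2 * k                         ∎
    where open ≤-Reasoning

module _ {k : ℕ} (k≥2 : k ≥ 2) where

  μ-distinctOdd : DistinctOddPartition (μ k)
  μ-distinctOdd with μ≡balancedPair k
  ... | j , j≥1 , j≤2 , odd , eq rewrite eq = balancedPair-distinctOdd j≥1 (≤-trans j≤2 k≥2) odd

  μ-sum : sum (μ k) ≡ 2 * k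
  μ-sum with μ≡balancedPair k
  ... | j , j≥1 , j≤2 , odd , eq rewrite eq = balancedPair-sum j≥1 (≤-trans j≤2 k≥2) odd

  μ-gap : part (μ k) 0 ∸ part (μ k) 1 ≤ 2 * k
  μ-gap with μ≡balancedPair k
  ... | j , j≥1 , j≤2 , odd , eq rewrite eq = balancedPair-gap j≥1 (≤-trans j≤2 k≥2) odd

μ≢[] : ∀ k → μ k ≢ []
μ≢[] k eq with μ≡balancedPair k
... | _ , _ , _ , _ , eq′ with () ← trans (sym eq′) eq

-- Marked partitions and the involution on odd marked partitions

_≡?_ : (xs ys : List ℕ) → Dec (xs ≡ ys)
_≡?_ = ≡-dec _≟_

-- (o , k , b) stands for the partition o ∪ (2k)^b whose b-th copy of 2k is marked.
Marked : Set
Marked = List ℕ × ℕ × ℕ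

rest : Marked → List ℕ
rest (l , _ , _) = l

half : Marked → ℕ
half (_ , k , _) = k

mult : Marked → ℕ
mult (_ , _ , b) = b

size : Marked → ℕ
size (o , k , b) = sum o + b * (2 * k)

OddMarked : Marked → Set
OddMarked (o , k , b) = DistinctOddPartition o × k ≥ 1 × b ≥ 1

Unpaired : Marked → Set
Unpaired (o , k , b) = part o 0 ∸ part o 1 ≤ 2 * k × (k ≥ 2 → o ≢ μ k) × (IsEven k → b ≡ 1 → o ≢ [])

up : Marked → Marked
up ([]    , suc zero , b) = [] , b , 1
up ([]    , k        , b) = μ k , k , b ∸ 1
up (d ∷ r , k        , b) = d + 2 * k ∷ r , k , b ∸ 1

down : Marked → Maybe Marked
down ([] , k , b) with (k % 2 ≟ 0) ×-dec (b ≟ 1)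
... | yes _ = just ([] , 1 , k)
... | no  _ = nothing
down (d ∷ r , k , b) with 2 * k <? d ∸ part r 0
... | yes _ = just (d ∸ 2 * k ∷ r , k , suc b)
... | no  _ with (2 ≤? k) ×-dec ((d ∷ r) ≡? μ k)
...   | yes _ = just ([] , k , suc b)
...   | no  _ = nothing

ι₂ : Marked → Marked
ι₂ t with mult t % 2 ≟ 0
... | yes _ = up t
... | no  _ = fromMaybe t (down t)

ι₂-even : ∀ t → IsEven (mult t) → ι₂ t ≡ up t
ι₂-even t even with mult t % 2 ≟ 0
... | yes _    = refl
... | no ¬even = contradiction even ¬even

ι₂-odd : ∀ t → IsOdd (mult t) → ι₂ t ≡ fromMaybe t (down t)
ι₂-odd t odd with mult t % 2 ≟ 0
... | yes even = contradiction odd (even⇒¬odd (mult t) even)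
... | no  _    = refl

down-[] : ∀ {k} → IsEven k → down ([] , k , 1) ≡ just ([] , 1 , k)
down-[] {k} even with (k % 2 ≟ 0) ×-dec (1 ≟ 1)
... | yes _  = refl
... | no  ¬c = contradiction (even , refl) ¬c

down-shrink : ∀ {d r k b} → 2 * k < d ∸ part r 0 → down (d ∷ r , k , b) ≡ just (d ∸ 2 * k ∷ r , k , suc b)
down-shrink {d} {r} {k} gap with 2 * k <? d ∸ part r 0
... | yes _   = refl
... | no ¬gap = contradiction gap ¬gap

down-μ : ∀ {d r k b} → k ≥ 2 → d ∷ r ≡ μ k → down (d ∷ r , k , b) ≡ just ([] , k , suc b)
down-μ {d} {r} {k} k≥2 eq with 2 * k <? d ∸ part r 0
... | yes gap = contradiction (subst (λ o → part o 0 ∸ part o 1 ≤ 2 * k) (sym eq) (μ-gap k≥2)) (<⇒≱ gap)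
... | no  _ with (2 ≤? k) ×-dec ((d ∷ r) ≡? μ k)
...   | yes _  = refl
...   | no  ¬c = contradiction (k≥2 , eq) ¬c

down-μk : ∀ {k b} → k ≥ 2 → down (μ k , k , b) ≡ just ([] , k , suc b)
down-μk {k} k≥2 with μ k in eq
... | []    = contradiction eq (μ≢[] k)
... | _ ∷ _ = down-μ k≥2 (sym eq)

shift-head-to-mult : ∀ d s b k → d + 2 * k + s + b * (2 * k) ≡ d + s + suc b * (2 * k)
shift-head-to-mult = solve-∀

record Paired (t t′ : Marked) : Set where
  field
    even-mult : IsEven (mult t)
    odd-mult  : IsOdd (mult t′)
    up≡       : up t ≡ t′
    down≡     : down t′ ≡ just t
    size≡     : size t′ ≡ size t
    source    : OddMarked t
    target    : OddMarked t′

up-paired : ∀ t → OddMarked t → IsEven (mult t) → Paired t (up t)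
up-paired ([] , suc zero , suc b) om even = record
  { even-mult = even ; odd-mult = refl ; up≡ = refl ; down≡ = down-[] even
  ; size≡ = lemma b ; source = om ; target = ([] , []) , s≤s z≤n , s≤s z≤n }
  where
  lemma : ∀ b → 0 + 1 * (2 * suc b) ≡ 0 + suc b * (2 * 1)
  lemma = solve-∀
up-paired ([] , k@(suc (suc _)) , suc b) om@(_ , k≥1 , _) even = record
  { even-mult = even ; odd-mult = odd ; up≡ = refl ; down≡ = down-μk k≥2
  ; size≡ = cong (_+ b * (2 * k)) (μ-sum k≥2)
  ; source = om ; target = μ-distinctOdd k≥2 , k≥1 , odd⇒≥1 odd }
  where
  k≥2 : k ≥ 2
  k≥2 = s≤s (s≤s z≤n)
  odd : IsOdd b
  odd = odd-pred b even
up-paired (d ∷ r , k , suc b) om@(dl@(_ , d-odd ∷ _) , k≥1 , _) even = record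
  { even-mult = even ; odd-mult = odd ; up≡ = refl
  ; down≡ = trans (down-shrink gap) (cong (λ x → just (x ∷ r , k , suc b)) (m+n∸n≡m d (2 * k)))
  ; size≡ = shift-head-to-mult d (sum r) b k ; source = om
  ; target = distinctOdd-replaceHead dl (<-≤-trans p<d (m≤m+n d (2 * k))) (trans (+-2*-parity d k) d-odd) ,
             k≥1 , odd⇒≥1 odd }
  where
  odd : IsOdd b
  odd = odd-pred b even
  p<d : part r 0 < d
  p<d = distinctOdd-head dl
  gap : 2 * k < d + 2 * k ∸ part r 0
  gap = subst (2 * k <_) (sym (+-∸-comm (2 * k) (<⇒≤ p<d))) (m<n+m (2 * k) (m<n⇒0<n∸m p<d))

down-paired : ∀ t {t′} → OddMarked t → IsOdd (mult t) → down t ≡ just t′ → Paired t′ t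
down-paired ([] , k , b) {t′} om@(_ , k≥1 , _) odd eq with (k % 2 ≟ 0) ×-dec (b ≟ 1)
down-paired ([] , k , .1) om@(_ , k≥1 , _) odd refl | yes (even , refl) = record
  { even-mult = even ; odd-mult = refl ; up≡ = refl ; down≡ = down-[] even
  ; size≡ = lemma k ; source = ([] , []) , s≤s z≤n , k≥1 ; target = om }
  where
  lemma : ∀ k → 0 + 1 * (2 * k) ≡ 0 + k * (2 * 1)
  lemma = solve-∀
down-paired (d ∷ r , k , b) om@(dl@(_ , d-odd ∷ _) , k≥1 , _) odd eq with 2 * k <? d ∸ part r 0
down-paired (d ∷ r , k , b) om@(dl@(_ , d-odd ∷ _) , k≥1 , _) odd refl | yes gap = record
  { even-mult = even-suc b odd ; odd-mult = odd
  ; up≡ = cong (λ x → x ∷ r , k , b) (m∸n+n≡m 2k≤d)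
  ; down≡ = down-shrink gap ; size≡ = size-eq
  ; source = distinctOdd-replaceHead dl p<d-2k d-2k-odd , k≥1 , s≤s z≤n ; target = om }
  where
  2k≤d : 2 * k ≤ d
  2k≤d = ≤-trans (<⇒≤ gap) (m∸n≤m d (part r 0))
  p+2k<d : part r 0 + 2 * k < d
  p+2k<d = subst (_< d) (+-comm (2 * k) (part r 0))
             (subst (2 * k + part r 0 <_) (m∸n+n≡m (<⇒≤ (distinctOdd-head dl))) (+-monoˡ-< (part r 0) gap))
  p<d-2k : part r 0 < d ∸ 2 * k
  p<d-2k = subst (_< d ∸ 2 * k) (m+n∸n≡m (part r 0) (2 * k)) (∸-monoˡ-< p+2k<d (m≤n+m (2 * k) (part r 0)))
  d-2k-odd : IsOdd (d ∸ 2 * k)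
  d-2k-odd = trans (sym (+-2*-parity (d ∸ 2 * k) k)) (subst IsOdd (sym (m∸n+n≡m 2k≤d)) d-odd)
  size-eq : d + sum r + b * (2 * k) ≡ d ∸ 2 * k + sum r + suc b * (2 * k)
  size-eq = trans (cong (λ x → x + sum r + b * (2 * k)) (sym (m∸n+n≡m 2k≤d)))
                  (shift-head-to-mult (d ∸ 2 * k) (sum r) b k)
... | no _ with (2 ≤? k) ×-dec ((d ∷ r) ≡? μ k)
down-paired (d ∷ r , k@(suc (suc _)) , b) om@(dl , k≥1 , _) odd refl | no _ | yes (k≥2 , eq) = record
  { even-mult = even-suc b odd ; odd-mult = odd ; up≡ = cong (_, k , b) (sym eq)
  ; down≡ = down-μ k≥2 eq ; size≡ = cong (_+ b * (2 * k)) (trans (cong sum eq) (μ-sum k≥2))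
  ; source = ([] , []) , k≥1 , s≤s z≤n ; target = om }
down-paired (_ ∷ _ , suc zero , _) _ _ refl | no _ | yes (s≤s () , _)

down-nothing⇒unpaired : ∀ t → down t ≡ nothing → Unpaired t
down-nothing⇒unpaired ([] , k , b) eq with (k % 2 ≟ 0) ×-dec (b ≟ 1)
... | no ¬c = z≤n , (λ _ → μ≢[] k ∘′ sym) , λ even b≡1 _ → ¬c (even , b≡1)
down-nothing⇒unpaired (d ∷ r , k , b) eq with 2 * k <? d ∸ part r 0
... | no ¬gap with (2 ≤? k) ×-dec ((d ∷ r) ≡? μ k)
...   | no ¬c = ≮⇒≥ ¬gap , (λ k≥2 eq → ¬c (k≥2 , eq)) , λ _ _ ()

unpaired⇒down-nothing : ∀ t → Unpaired t → down t ≡ nothing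
unpaired⇒down-nothing ([] , k , b) (_ , _ , ¬[]) with (k % 2 ≟ 0) ×-dec (b ≟ 1)
... | yes (even , b≡1) = contradiction refl (¬[] even b≡1)
... | no _             = refl
unpaired⇒down-nothing (d ∷ r , k , b) (gap≤ , ¬μ , _) with 2 * k <? d ∸ part r 0
... | yes gap = contradiction gap≤ (<⇒≱ gap)
... | no _ with (2 ≤? k) ×-dec ((d ∷ r) ≡? μ k)
...   | yes (k≥2 , eq) = contradiction eq (¬μ k≥2)
...   | no _           = refl

PairedWith : Marked → Marked → Set
PairedWith t t′ = Paired t t′ ⊎ Paired t′ t

ι₂-cases : ∀ t → OddMarked t → (ι₂ t ≡ t × IsOdd (mult t) × Unpaired t) ⊎ PairedWith t (ι₂ t)
ι₂-cases t om with parity (mult t)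
... | inj₁ even = inj₂ (inj₁ (subst (Paired t) (sym (ι₂-even t even)) (up-paired t om even)))
... | inj₂ odd with down t in eq
...   | just t′ = inj₂ (inj₂ (subst (λ u → Paired u t) (sym (trans (ι₂-odd t odd) (cong (fromMaybe t) eq)))
                                    (down-paired t om odd eq)))
...   | nothing = inj₁ (trans (ι₂-odd t odd) (cong (fromMaybe t) eq) , odd , down-nothing⇒unpaired t eq)

unpaired⇒ι₂-fixed : ∀ t → IsOdd (mult t) → Unpaired t → ι₂ t ≡ t
unpaired⇒ι₂-fixed t odd unpaired = trans (ι₂-odd t odd) (cong (fromMaybe t) (unpaired⇒down-nothing t unpaired))

pairedWith-ι₂ : ∀ {t t′} → PairedWith t t′ → ι₂ t′ ≡ t
pairedWith-ι₂ {t} {t′} (inj₁ p) =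
  trans (ι₂-odd t′ (Paired.odd-mult p)) (cong (fromMaybe t′) (Paired.down≡ p))
pairedWith-ι₂ {t} {t′} (inj₂ p) = trans (ι₂-even t′ (Paired.even-mult p)) (Paired.up≡ p)

pairedWith-sign : ∀ {t t′} → PairedWith t t′ → sign (suc (mult t′)) ≡ - sign (suc (mult t))
pairedWith-sign {t} {t′} (inj₁ p) = begin
  sign (suc (mult t′))   ≡⟨ sign-even (suc (mult t′)) (even-suc (mult t′) (Paired.odd-mult p)) ⟩
  1ℤ                     ≡⟨⟩
  - -1ℤ                  ≡⟨ cong -_ (sign-odd (suc (mult t)) (odd-suc (mult t) (Paired.even-mult p))) ⟨
  - sign (suc (mult t))  ∎
  where open ≡-Reasoning
pairedWith-sign {t} {t′} (inj₂ p) = begin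
  sign (suc (mult t′))   ≡⟨ sign-odd (suc (mult t′)) (odd-suc (mult t′) (Paired.even-mult p)) ⟩
  -1ℤ                    ≡⟨⟩
  - 1ℤ                   ≡⟨ cong -_ (sign-even (suc (mult t)) (even-suc (mult t) (Paired.odd-mult p))) ⟨
  - sign (suc (mult t))  ∎
  where open ≡-Reasoning

pairedWith-≢ : ∀ {t t′} → PairedWith t t′ → t′ ≢ t
pairedWith-≢ {t} (inj₁ p) refl = even⇒¬odd (mult t) (Paired.even-mult p) (Paired.odd-mult p)
pairedWith-≢ {t} (inj₂ p) refl = even⇒¬odd (mult t) (Paired.even-mult p) (Paired.odd-mult p)

pairedWith-size : ∀ {t t′} → PairedWith t t′ → size t′ ≡ size t
pairedWith-size (inj₁ p) = Paired.size≡ p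
pairedWith-size (inj₂ p) = sym (Paired.size≡ p)

pairedWith-oddMarked : ∀ {t t′} → PairedWith t t′ → OddMarked t′
pairedWith-oddMarked (inj₁ p) = Paired.target p
pairedWith-oddMarked (inj₂ p) = Paired.source p

record Valid (n : ℕ) (t : Marked) : Set where
  constructor valid
  field
    sorted   : Sorted (rest t)
    positive : All (_> 0) (rest t)
    half≥1   : half t ≥ 1
    mult≥1   : mult t ≥ 1
    size≡    : size t ≡ n

-- (-1)^(ℓ_ev(λ) + 1) for the encoded partition λ
weight : Marked → ℤ
weight (l , _ , b) = sign (ℓev l + suc b)

weight-oddMarked : ∀ t → All IsOdd (rest t) → weight t ≡ sign (suc (mult t))
weight-oddMarked (l , _ , b) odds = cong (λ e → sign (e + suc b)) (ℓev-odd odds)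

oddMarked-valid : ∀ {n t} → OddMarked t → size t ≡ n → Valid n t
oddMarked-valid (dl , k≥1 , b≥1) = valid (distinctOdd-sorted dl) (distinctOdd-positive dl) k≥1 b≥1

distinctOdd⇒leastActive : ∀ {l} → DistinctOddPartition l → leastActive l ≡ nothing
distinctOdd⇒leastActive {l} dl = firstFrom-none (active? l) 1 (sum l) (λ _ → distinctOdd⇒inactive dl)

leastActive-nothing⇒distinctOdd : ∀ {l} → Sorted l → All (_> 0) l → leastActive l ≡ nothing →
                                  DistinctOddPartition l
leastActive-nothing⇒distinctOdd {l} l↗ l>0 eq =
  inactive⇒distinctOdd l↗ l>0 (firstFrom-nothing (active? l) 1 (sum l) eq)

valid-oddMarked : ∀ {n l k b} → Valid n (l , k , b) → leastActive l ≡ nothing → OddMarked (l , k , b)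
valid-oddMarked (valid l↗ l>0 k≥1 b≥1 _) eq = leastActive-nothing⇒distinctOdd l↗ l>0 eq , k≥1 , b≥1

glaisher-leastActive : ∀ {l y} → leastActive l ≡ just y → leastActive (glaisher y l) ≡ just y
glaisher-leastActive {l} {y} eq with firstFrom-just (active? l) 1 (sum l) eq
... | act , y≥1 , below = firstFrom-least (active? g) 1 (sum g) (glaisher-active y≥1 act , y≥1 , below′)
                            (s≤s (active⇒≤sum y≥1 (glaisher-active y≥1 act)))
  where
  g = glaisher y l
  below′ : ∀ z → 1 ≤ z → z < y → ¬ Active g z
  below′ z z≥1 z<y = below z z≥1 z<y ∘′ related-active-below y≥1 (glaisher-related act) z<y

ι : Marked → Marked
ι (l , k , b) with leastActive l
... | just y  = glaisher y l , k , b
... | nothing = ι₂ (l , k , b)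

ι-just : ∀ l k b {y} → leastActive l ≡ just y → ι (l , k , b) ≡ (glaisher y l , k , b)
ι-just l k b eq rewrite eq = refl

ι-nothing : ∀ l k b → leastActive l ≡ nothing → ι (l , k , b) ≡ ι₂ (l , k , b)
ι-nothing l k b eq rewrite eq = refl

ι-distinctOdd : ∀ t → DistinctOddPartition (rest t) → ι t ≡ ι₂ t
ι-distinctOdd (l , k , b) dl = ι-nothing l k b (distinctOdd⇒leastActive dl)

ι-valid : ∀ {n} t → Valid n t → Valid n (ι t)
ι-valid (l , k , b) (valid l↗ l>0 k≥1 b≥1 size≡n) with leastActive l in eq
... | just y with firstFrom-just (active? l) 1 (sum l) eq
...   | act , y≥1 , _ = valid (glaisher-sorted y l↗) (related-positive y≥1 rel l>0) k≥1 b≥1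
                              (trans (cong (_+ b * (2 * k)) (related-sum rel)) size≡n)
  where rel = glaisher-related act
ι-valid (l , k , b) v@(valid _ _ _ _ size≡n) | nothing with ι₂-cases (l , k , b) (valid-oddMarked v eq)
...   | inj₁ (fixed , _) = subst (Valid _) (sym fixed) v
...   | inj₂ paired = oddMarked-valid (pairedWith-oddMarked paired) (trans (pairedWith-size paired) size≡n)

ι-involutive : ∀ {n} t → Valid n t → ι (ι t) ≡ t
ι-involutive (l , k , b) (valid l↗ _ _ _ _) with leastActive l in eq
... | just y with firstFrom-just (active? l) 1 (sum l) eq
...   | act , y≥1 , _ = trans (ι-just (glaisher y l) k b (glaisher-leastActive {l} {y} eq))
                              (cong (_, k , b) (glaisher-involutive y≥1 l↗ act))
ι-involutive (l , k , b) v | nothing with ι₂-cases (l , k , b) (valid-oddMarked v eq)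
...   | inj₁ (fixed , _) = trans (cong ι fixed) (trans (ι-nothing l k b eq) fixed)
...   | inj₂ paired = trans (ι-distinctOdd (ι₂ (l , k , b)) (proj₁ (pairedWith-oddMarked paired)))
                            (pairedWith-ι₂ paired)

ι-sign : ∀ {n} t → Valid n t → ι t ≢ t → weight (ι t) ≡ - weight t
ι-sign (l , k , b) v moved with leastActive l in eq
... | just y = related-sign (suc b) (glaisher-related (proj₁ (firstFrom-just (active? l) 1 (sum l) eq)))
... | nothing with ι₂-cases (l , k , b) (valid-oddMarked v eq)
...   | inj₁ (fixed , _) = contradiction fixed moved
...   | inj₂ paired = begin
  weight t′                 ≡⟨ weight-oddMarked t′ (proj₂ (proj₁ (pairedWith-oddMarked paired))) ⟩
  sign (suc (mult t′))      ≡⟨ pairedWith-sign paired ⟩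
  - sign (suc b)            ≡⟨ cong -_ (weight-oddMarked (l , k , b) (proj₂ (proj₁ (valid-oddMarked v eq)))) ⟨
  - weight (l , k , b)      ∎
  where
  open ≡-Reasoning
  t′ = ι₂ (l , k , b)

ι-fixed : ∀ {n} t → Valid n t → ι t ≡ t → OddMarked t × IsOdd (mult t) × Unpaired t
ι-fixed (l , k , b) v fixed with leastActive l in eq
... | just y with firstFrom-just (active? l) 1 (sum l) eq
...   | act , y≥1 , _ = contradiction (cong rest fixed) (glaisher-≢ y≥1 act)
ι-fixed (l , k , b) v fixed | nothing with ι₂-cases (l , k , b) (valid-oddMarked v eq)
...   | inj₁ (_ , odd , unpaired) = valid-oddMarked v eq , odd , unpaired
...   | inj₂ paired = contradiction fixed (pairedWith-≢ paired)

unpaired⇒ι-fixed : ∀ t → DistinctOddPartition (rest t) → IsOdd (mult t) → Unpaired t → ι t ≡ t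
unpaired⇒ι-fixed t dl odd unpaired = trans (ι-distinctOdd t dl) (unpaired⇒ι₂-fixed t odd unpaired)

∑ : {A : Set} → (A → ℤ) → List A → ℤ
∑ f xs = foldr ℤ._+_ 0ℤ (map f xs)

module _ {A : Set} where

  ∑-↭ : ∀ (f : A → ℤ) {xs ys} → xs ↭ ys → ∑ f xs ≡ ∑ f ys
  ∑-↭ f p = foldr-commMonoid ℤ+.setoid ℤ+.isCommutativeMonoid (↭⇒↭ₛ (map⁺ f p))
    where module ℤ+ = CommutativeMonoid ℤP.+-0-commutativeMonoid

  ∑-++ : ∀ (f : A → ℤ) xs ys → ∑ f (xs ++ ys) ≡ ∑ f xs ℤ.+ ∑ f ys
  ∑-++ f []       ys = sym (ℤP.+-identityˡ _)
  ∑-++ f (x ∷ xs) ys = trans (cong (λ s → f x ℤ.+ s) (∑-++ f xs ys)) (sym (ℤP.+-assoc (f x) _ _))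

  ∑-cong : ∀ {f g : A → ℤ} xs → (∀ {x} → x ∈ xs → f x ≡ g x) → ∑ f xs ≡ ∑ g xs
  ∑-cong []       _  = refl
  ∑-cong (x ∷ xs) eq = cong₂ ℤ._+_ (eq (here refl)) (∑-cong xs (eq ∘′ there))

  ∑-const : ∀ c (xs : List A) → ∑ (λ _ → c) xs ≡ c ℤ.* + length xs
  ∑-const c []       = sym (ℤP.*-zeroʳ c)
  ∑-const c (x ∷ xs) = trans (cong (λ s → c ℤ.+ s) (∑-const c xs)) (sym (ℤP.*-suc c (+ length xs)))

  ∑-neg : ∀ (f : A → ℤ) xs → ∑ (λ x → - f x) xs ≡ - ∑ f xs
  ∑-neg f []       = refl
  ∑-neg f (x ∷ xs) = trans (cong (λ s → - f x ℤ.+ s) (∑-neg f xs)) (sym (ℤP.neg-distrib-+ (f x) (∑ f xs)))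

  ∑-map : ∀ {B : Set} (f : A → ℤ) (g : B → A) xs → ∑ f (map g xs) ≡ ∑ (f ∘′ g) xs
  ∑-map f g xs = cong (foldr ℤ._+_ 0ℤ) (sym (map-∘ xs))

  filter-∁-↭ : ∀ {P : A → Set} (P? : Decidable P) xs → xs ↭ filter P? xs ++ filter (∁? P?) xs
  filter-∁-↭ P? []       = ↭-refl
  filter-∁-↭ P? (x ∷ xs) with P? x
  ... | yes _ = prep x (filter-∁-↭ P? xs)
  ... | no  _ = ↭-trans (prep x (filter-∁-↭ P? xs)) (↭-sym (shift x (filter P? xs) (filter (∁? P?) xs)))

  unique-↭ : ∀ {xs ys : List A} → Unique xs → Unique ys →
             (∀ {x} → x ∈ xs → x ∈ ys) → (∀ {x} → x ∈ ys → x ∈ xs) → xs ↭ ys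
  unique-↭ xs! ys! to from = ∼bag⇒↭ (unique∧set⇒bag xs! ys! (mk⇔ to from))

  map-unique : ∀ {B : Set} (f : A → B) {xs} → Unique xs →
               (∀ {x y} → x ∈ xs → y ∈ xs → f x ≡ f y → x ≡ y) → Unique (map f xs)
  map-unique f {[]}     []          _   = []
  map-unique f {x ∷ xs} (x∉xs ∷ xs!) inj =
    AllP.map⁺ (All.tabulate (λ y∈ fx≡fy → All.lookup x∉xs y∈ (inj (here refl) (there y∈) fx≡fy))) ∷
    map-unique f xs! (λ x∈ y∈ → inj (there x∈) (there y∈))

self-negating : ∀ {i} → i ≡ - i → i ≡ 0ℤ
self-negating {+ zero}   _ = refl
self-negating {+ suc _}  ()
self-negating {ℤ.-[1+ _ ]} ()

module _ {A : Set} (_≟ᴬ_ : DecidableEquality A) (ι : A → A) (w : A → ℤ) where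

  ∑-signReversing : ∀ {xs} → Unique xs →
                    (∀ {x} → x ∈ xs → ι x ∈ xs) → (∀ {x} → x ∈ xs → ι (ι x) ≡ x) →
                    (∀ {x} → x ∈ xs → ι x ≢ x → w (ι x) ≡ - w x) →
                    ∑ w xs ≡ ∑ w (filter (λ x → ι x ≟ᴬ x) xs)
  ∑-signReversing {xs} xs! closed involutive reversing = begin
    ∑ w xs               ≡⟨ ∑-↭ w (filter-∁-↭ fixed? xs) ⟩
    ∑ w (F ++ N)         ≡⟨ ∑-++ w F N ⟩
    ∑ w F ℤ.+ ∑ w N      ≡⟨ cong (λ s → ∑ w F ℤ.+ s) (self-negating N-balanced) ⟩
    ∑ w F ℤ.+ 0ℤ         ≡⟨ ℤP.+-identityʳ (∑ w F) ⟩
    ∑ w F                ∎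
    where
    open ≡-Reasoning
    fixed? = λ x → ι x ≟ᴬ x
    F = filter fixed? xs
    N = filter (∁? fixed?) xs
    N⁻ : ∀ {x} → x ∈ N → x ∈ xs × ι x ≢ x
    N⁻ = ∈-filter⁻ (∁? fixed?)
    ι∈N : ∀ {x} → x ∈ N → ι x ∈ N
    ι∈N x∈N with N⁻ x∈N
    ... | x∈ , moved =
      ∈-filter⁺ (∁? fixed?) (closed x∈) (λ ιιx≡ιx → moved (trans (sym ιιx≡ιx) (involutive x∈)))
    ιN↭N : map ι N ↭ N
    ιN↭N = unique-↭ (map-unique ι N! (λ x∈ y∈ eq → trans (sym (involutive (proj₁ (N⁻ x∈))))
                                                          (trans (cong ι eq) (involutive (proj₁ (N⁻ y∈))))))
                     N!
                     (λ y∈ → let x , x∈N , y≡ιx = ∈-map⁻ ι y∈ in subst (_∈ N) (sym y≡ιx) (ι∈N x∈N))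
                     (λ x∈N → subst (_∈ map ι N) (involutive (proj₁ (N⁻ x∈N))) (∈-map⁺ ι (ι∈N x∈N)))
      where N! = Unique.filter⁺ (∁? fixed?) xs!
    N-balanced : ∑ w N ≡ - ∑ w N
    N-balanced = begin
      ∑ w N                   ≡⟨ ∑-↭ w ιN↭N ⟨
      ∑ w (map ι N)           ≡⟨ ∑-map w ι N ⟩
      ∑ (w ∘′ ι) N            ≡⟨ ∑-cong N (λ x∈N → uncurry reversing (N⁻ x∈N)) ⟩
      ∑ (λ x → - w x) N       ≡⟨ ∑-neg w N ⟩
      - ∑ w N                 ∎

module _ {A : Set} (f : A → ℕ) where

  private
    O E : List A → ℕ
    O xs = sum (map f (filter (λ x → f x % 2 ≟ 1) xs))
    E xs = sum (map f (filter (λ x → f x % 2 ≟ 0) xs))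

  odd-minus-even : ∀ xs → + O xs - + E xs ≡ ∑ (λ x → sign (suc (f x)) ℤ.* + f x) xs
  odd-minus-even []       = refl
  odd-minus-even (x ∷ xs) with parity (f x)
  ... | inj₂ odd = begin
    + O (x ∷ xs) - + E (x ∷ xs)
      ≡⟨ cong₂ (λ o e → + sum (map f o) - + sum (map f e))
               (filter-accept (λ x → f x % 2 ≟ 1) {x} {xs} odd)
               (filter-reject (λ x → f x % 2 ≟ 0) {x} {xs} (λ even → even⇒¬odd (f x) even odd)) ⟩
    + (f x + O xs) - + E xs             ≡⟨ cong (λ i → i - + E xs) (ℤP.pos-+ (f x) (O xs)) ⟩
    + f x ℤ.+ + O xs - + E xs           ≡⟨ lemma (+ f x) (+ O xs) (+ E xs) ⟩
    + f x ℤ.+ (+ O xs - + E xs)         ≡⟨ cong₂ ℤ._+_ coefficient (odd-minus-even xs) ⟩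
    sign (suc (f x)) ℤ.* + f x ℤ.+ ∑ (λ x → sign (suc (f x)) ℤ.* + f x) xs ∎
    where
    open ≡-Reasoning
    lemma : ∀ a b c → a ℤ.+ b - c ≡ a ℤ.+ (b - c)
    lemma = ℤ-Solver.solve-∀
    coefficient : + f x ≡ sign (suc (f x)) ℤ.* + f x
    coefficient = sym (trans (cong (ℤ._* + f x) (sign-even (suc (f x)) (even-suc (f x) odd)))
                             (ℤP.*-identityˡ (+ f x)))
  ... | inj₁ even = begin
    + O (x ∷ xs) - + E (x ∷ xs)
      ≡⟨ cong₂ (λ o e → + sum (map f o) - + sum (map f e))
               (filter-reject (λ x → f x % 2 ≟ 1) {x} {xs} (even⇒¬odd (f x) even))
               (filter-accept (λ x → f x % 2 ≟ 0) {x} {xs} even) ⟩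
    + O xs - + (f x + E xs)             ≡⟨ cong (λ i → + O xs - i) (ℤP.pos-+ (f x) (E xs)) ⟩
    + O xs - (+ f x ℤ.+ + E xs)         ≡⟨ lemma (+ f x) (+ O xs) (+ E xs) ⟩
    - + f x ℤ.+ (+ O xs - + E xs)       ≡⟨ cong₂ ℤ._+_ coefficient (odd-minus-even xs) ⟩
    sign (suc (f x)) ℤ.* + f x ℤ.+ ∑ (λ x → sign (suc (f x)) ℤ.* + f x) xs ∎
    where
    open ≡-Reasoning
    lemma : ∀ a b c → b - (a ℤ.+ c) ≡ - a ℤ.+ (b - c)
    lemma = ℤ-Solver.solve-∀
    coefficient : - + f x ≡ sign (suc (f x)) ℤ.* + f x
    coefficient = sym (trans (cong (ℤ._* + f x) (sign-odd (suc (f x)) (odd-suc (f x) even)))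
                             (ℤP.-1*i≡-i (+ f x)))

module _ {A B : Set} (f : A → List B) where

  concatMap-unique : ∀ (g : B → A) {xs} → Unique xs → (∀ {x} → x ∈ xs → Unique (f x)) →
                     (∀ {x y} → x ∈ xs → y ∈ f x → g y ≡ x) → Unique (concatMap f xs)
  concatMap-unique g {[]}     []           _       _    = []
  concatMap-unique g {x ∷ xs} (x∉xs ∷ xs!) unique-f left =
    Unique.++⁺ (unique-f (here refl)) (concatMap-unique g xs! (unique-f ∘′ there) (left ∘′ there)) disjoint
    where
    disjoint : ∀ {v} → ¬ (v ∈ f x × v ∈ concatMap f xs)
    disjoint (v∈fx , v∈rest) with find (∈-concatMap⁻ f v∈rest)
    ... | x′ , x′∈xs , v∈fx′ =
      All.lookup x∉xs x′∈xs (trans (sym (left (here refl) v∈fx)) (left (there x′∈xs) v∈fx′))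

  ∑-concatMap : ∀ (w : B → ℤ) xs → ∑ w (concatMap f xs) ≡ ∑ (∑ w ∘′ f) xs
  ∑-concatMap w []       = refl
  ∑-concatMap w (x ∷ xs) =
    trans (∑-++ w (f x) (concatMap f xs)) (cong (λ s → ∑ w (f x) ℤ.+ s) (∑-concatMap w xs))

-- Enumerating marked partitions

-- One entry (k , j) for each occurrence of an even part 2k, where j counts the copies of 2k
-- from that occurrence on.
marks : List ℕ → List (ℕ × ℕ)
marks []       = []
marks (x ∷ xs) with x % 2 ≟ 0
... | yes _ = (x / 2 , count x (x ∷ xs)) ∷ marks xs
... | no  _ = marks xs

marks-length : ∀ l → length (marks l) ≡ ℓev l
marks-length []       = refl
marks-length (x ∷ xs) with x % 2 ≟ 0
... | yes even = trans (cong suc (marks-length xs)) (sym (ℓev-∷-even x xs even))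
... | no  ¬even = trans (marks-length xs) (sym (ℓev-∷-odd x xs (¬even⇒odd x ¬even)))

∈-marks⁻ : ∀ {k j} l → (k , j) ∈ marks l → 1 ≤ j × j ≤ count (2 * k) l
∈-marks⁻ (x ∷ xs) m∈ with x % 2 ≟ 0
∈-marks⁻ (x ∷ xs) (here refl) | yes even rewrite half-even x even =
  ∈⇒count≥1 {x} {x ∷ xs} (here refl) , ≤-refl
∈-marks⁻ {k} (x ∷ xs) (there m∈) | yes _ =
  let j≥1 , j≤c = ∈-marks⁻ xs m∈ in j≥1 , ≤-trans j≤c (count-∷-≤ (2 * k) x xs)
∈-marks⁻ {k} (x ∷ xs) m∈ | no _ =
  let j≥1 , j≤c = ∈-marks⁻ xs m∈ in j≥1 , ≤-trans j≤c (count-∷-≤ (2 * k) x xs)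

marks-∷ : ∀ x {m} xs → m ∈ marks xs → m ∈ marks (x ∷ xs)
marks-∷ x xs m∈ with x % 2 ≟ 0
... | yes _ = there m∈
... | no  _ = m∈

∈-marks⁺ : ∀ {k j} l → 1 ≤ j → j ≤ count (2 * k) l → (k , j) ∈ marks l
∈-marks⁺ []       j≥1 j≤0 = contradiction (≤-trans j≥1 j≤0) λ ()
∈-marks⁺ {k} {j} (x ∷ xs) j≥1 j≤c with x ≟ 2 * k
... | no x≢2k = marks-∷ x xs (∈-marks⁺ xs j≥1 (≤-trans j≤c (≤-reflexive (count-∷-≢ xs x≢2k))))
... | yes refl with m≤n⇒m<n∨m≡n (≤-trans j≤c (≤-reflexive (count-∷-≡ (2 * k) xs)))
...   | inj₁ j<c = marks-∷ (2 * k) xs (∈-marks⁺ xs j≥1 (≤-pred j<c))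
...   | inj₂ j≡c with (2 * k) % 2 ≟ 0
...     | yes _     = here (cong₂ _,_ (sym (half-2* k)) (trans j≡c (sym (count-∷-≡ (2 * k) xs))))
...     | no  ¬even = contradiction (even-2* k) ¬even

marks-unique : ∀ l → Unique (marks l)
marks-unique []       = []
marks-unique (x ∷ xs) with x % 2 ≟ 0
... | no  _    = marks-unique xs
... | yes even = All.tabulate fresh ∷ marks-unique xs
  where
  fresh : ∀ {m} → m ∈ marks xs → (x / 2 , count x (x ∷ xs)) ≢ m
  fresh m∈ refl with ∈-marks⁻ xs m∈
  ... | _ , c≤ = n≮n (count x xs) (≤-trans (≤-reflexive (sym (count-∷-≡ x xs)))
                                            (subst (λ y → count x (x ∷ xs) ≤ count y xs) (half-even x even) c≤))

mark : List ℕ → ℕ × ℕ → Marked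
mark l (k , j) = removeAll (replicate j (2 * k)) l , k , j

unmark : Marked → List ℕ
unmark (o , k , b) = insertAll (replicate b (2 * k)) o

↭-replicate-removeAll : ∀ {j x l} → j ≤ count x l → l ↭ replicate j x ++ removeAll (replicate j x) l
↭-replicate-removeAll {j} {x} {l} j≤c =
  let _ , p = ↭-replicate-++ j x l j≤c
  in ↭-trans p (++⁺ˡ (replicate j x) (↭-sym (removeAll-↭ (replicate j x) p)))

unmark-↭ : ∀ t → unmark t ↭ replicate (mult t) (2 * half t) ++ rest t
unmark-↭ (o , k , b) = insertAll-↭ (replicate b (2 * k)) o

unmark-mark : ∀ {l k j} → Sorted l → j ≤ count (2 * k) l → unmark (mark l (k , j)) ≡ l
unmark-mark {k = k} {j} l↗ j≤c = insertAll-removeAll (replicate j (2 * k)) l↗ (↭-replicate-removeAll j≤c)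

mark-unmark : ∀ {o k b} → Sorted o → mark (unmark (o , k , b)) (k , b) ≡ (o , k , b)
mark-unmark {k = k} {b} o↗ = cong (_, k , b) (removeAll-insertAll (replicate b (2 * k)) o↗)

unmark-partition : ∀ {n} t → Valid n t → IsPartition n (unmark t)
unmark-partition t@(o , k , b) (valid o↗ o>0 k≥1 _ size≡n) =
  insertAll-sorted (replicate b (2 * k)) o↗ ,
  All-resp-↭ (↭-sym (unmark-↭ t)) (AllP.++⁺ (AllP.replicate⁺ b (≤-trans k≥1 (m≤m+n k (k + 0)))) o>0) ,
  trans (sum-↭ (unmark-↭ t)) (trans (sum-replicate-++ b (2 * k) o) size≡n)

mark-valid : ∀ {n l k j} → IsPartition n l → (k , j) ∈ marks l → Valid n (mark l (k , j))
mark-valid {l = l} {k} {j} (l↗ , l>0 , sum≡n) m∈ =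
  valid (removeAll-sorted (replicate j (2 * k)) l↗) (AllP.++⁻ʳ (replicate j (2 * k)) (All-resp-↭ l↭ l>0))
        (positive-half k (All.lookup l>0 (count≥1⇒∈ (2 * k) l (≤-trans j≥1 j≤c)))) j≥1
        (trans (sym (sum-replicate-++ j (2 * k) _)) (trans (sum-↭ (↭-sym l↭)) sum≡n))
  where
  j≥1 = proj₁ (∈-marks⁻ l m∈)
  j≤c = proj₂ (∈-marks⁻ l m∈)
  l↭ = ↭-replicate-removeAll j≤c

fibre : List ℕ → List Marked
fibre l = map (mark l) (marks l)

∑-fibre : ∀ l → ∑ weight (fibre l) ≡ sign (suc (ℓev l)) ℤ.* + ℓev l
∑-fibre l = begin
  ∑ weight (map (mark l) (marks l))      ≡⟨ ∑-map weight (mark l) (marks l) ⟩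
  ∑ (weight ∘′ mark l) (marks l)          ≡⟨ ∑-cong (marks l) weight-mark ⟩
  ∑ (λ _ → sign (suc (ℓev l))) (marks l) ≡⟨ ∑-const (sign (suc (ℓev l))) (marks l) ⟩
  sign (suc (ℓev l)) ℤ.* + length (marks l) ≡⟨ cong (λ m → sign (suc (ℓev l)) ℤ.* + m) (marks-length l) ⟩
  sign (suc (ℓev l)) ℤ.* + ℓev l          ∎
  where
  open ≡-Reasoning
  weight-mark : ∀ {m} → m ∈ marks l → weight (mark l m) ≡ sign (suc (ℓev l))
  weight-mark {k , j} m∈ = cong sign (begin
    ℓev R + suc j              ≡⟨ +-suc (ℓev R) j ⟩
    suc (ℓev R + j)            ≡⟨ cong suc (+-comm (ℓev R) j) ⟩
    suc (j + ℓev R)            ≡⟨ cong suc (ℓev-replicate-++ j k R) ⟨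
    suc (ℓev (replicate j (2 * k) ++ R)) ≡⟨ cong suc (ℓev-↭ (↭-replicate-removeAll (proj₂ (∈-marks⁻ l m∈)))) ⟨
    suc (ℓev l)                ∎)
    where R = removeAll (replicate j (2 * k)) l

count-unmark≡mult : ∀ t → All IsOdd (rest t) → count (2 * half t) (unmark t) ≡ mult t
count-unmark≡mult t@(o , k , b) odds = begin
  count (2 * k) (unmark t)                   ≡⟨ count-↭ (2 * k) (unmark-↭ t) ⟩
  count (2 * k) (replicate b (2 * k) ++ o)   ≡⟨ count-replicate-++ b (2 * k) o ⟩
  b + count (2 * k) o                        ≡⟨ cong (λ c → b + c) (count-even-in-odd≡0 k odds) ⟩
  b + 0                                      ≡⟨ +-identityʳ b ⟩
  b                                          ∎
  where open ≡-Reasoning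

unmark-injective : ∀ {o k b o′ k′ b′} → Sorted o → All IsOdd o → b ≥ 1 → Sorted o′ → All IsOdd o′ →
                   unmark (o , k , b) ≡ unmark (o′ , k′ , b′) → (o , k , b) ≡ (o′ , k′ , b′)
unmark-injective {o} {k} {b} {o′} {k′} {b′} o↗ odds b≥1 o′↗ odds′ eq with k′ ≟ k
... | no k′≢k =
  contradiction (≤-trans b≥1 (≤-reflexive (trans (sym (count-unmark≡mult (o , k , b) odds)) count≡0))) λ ()
  where
  count≡0 : count (2 * k) (unmark (o , k , b)) ≡ 0
  count≡0 = begin
    count (2 * k) (unmark (o , k , b))   ≡⟨ cong (count (2 * k)) eq ⟩
    count (2 * k) (unmark (o′ , k′ , b′)) ≡⟨ count-↭ (2 * k) (unmark-↭ (o′ , k′ , b′)) ⟩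
    count (2 * k) (replicate b′ (2 * k′) ++ o′) ≡⟨ count-replicate-++-≢ b′ o′ (k′≢k ∘′ *-cancelˡ-≡ k′ k 2) ⟩
    count (2 * k) o′                     ≡⟨ count-even-in-odd≡0 k odds′ ⟩
    0                                    ∎
    where open ≡-Reasoning
... | yes refl = begin
  (o , k , b)                  ≡⟨ mark-unmark o↗ ⟨
  mark (unmark (o , k , b)) (k , b)  ≡⟨ cong₂ mark eq (cong (k ,_) b≡b′) ⟩
  mark (unmark (o′ , k , b′)) (k , b′) ≡⟨ mark-unmark o′↗ ⟩
  (o′ , k , b′)                ∎
  where
  open ≡-Reasoning
  b≡b′ : b ≡ b′
  b≡b′ = trans (sym (count-unmark≡mult (o , k , b) odds))
               (trans (cong (count (2 * k)) eq) (count-unmark≡mult (o′ , k , b′) odds′))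

_≟ₘ_ : DecidableEquality Marked
_≟ₘ_ = ×-≡-dec (≡-dec _≟_) (×-≡-dec _≟_ _≟_)

module Enumeration (n : ℕ) (L : List (List ℕ)) (L! : Unique L)
                   (L-spec : ∀ λ′ → (λ′ ∈ L → IsPartition n λ′) × (IsPartition n λ′ → λ′ ∈ L)) where

  marked : List Marked
  marked = concatMap fibre L

  marked-valid : ∀ {t} → t ∈ marked → Valid n t
  marked-valid t∈ with find (∈-concatMap⁻ fibre t∈)
  ... | l , l∈L , t∈fibre with ∈-map⁻ (mark l) t∈fibre
  ...   | m , m∈ , refl = mark-valid (proj₁ (L-spec l) l∈L) m∈

  marked-complete : ∀ {t} → Valid n t → t ∈ marked
  marked-complete {t@(o , k , b)} v@(valid o↗ _ _ b≥1 _) =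
    ∈-concatMap⁺ fibre (lose λ′∈L (subst (_∈ fibre λ′) (mark-unmark o↗) (∈-map⁺ (mark λ′) kb∈)))
    where
    λ′ = unmark t
    λ′∈L = proj₂ (L-spec λ′) (unmark-partition t v)
    kb∈ : (k , b) ∈ marks λ′
    kb∈ = ∈-marks⁺ λ′ b≥1 (subst (b ≤_) (sym (trans (count-↭ (2 * k) (unmark-↭ t)) (count-replicate-++ b (2 * k) o)))
                                  (m≤m+n b (count (2 * k) o)))

  marked-unique : Unique marked
  marked-unique = concatMap-unique fibre unmark L!
    (λ {l} _ → map-unique (mark l) (marks-unique l) λ _ _ eq → cong₂ _,_ (cong half eq) (cong mult eq))
    (λ {l} l∈L t∈ → let (k , j) , m∈ , t≡ = ∈-map⁻ (mark l) t∈ in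
      trans (cong unmark t≡)
            (unmark-mark {k = k} {j} (proj₁ (proj₁ (L-spec l) l∈L)) (proj₂ (∈-marks⁻ l m∈))))

  ∑-marked : ∑ weight marked ≡ ∑ (λ λ′ → sign (suc (ℓev λ′)) ℤ.* + ℓev λ′) L
  ∑-marked = trans (∑-concatMap fibre weight L) (∑-cong L (λ {l} _ → ∑-fibre l))

  fixed : List Marked
  fixed = filter (λ t → ι t ≟ₘ t) marked

  ∑-fixed : ∑ weight marked ≡ + length fixed
  ∑-fixed = begin
    ∑ weight marked                ≡⟨ ∑-signReversing _≟ₘ_ ι weight marked-unique
                                        (marked-complete ∘′ ι-valid _ ∘′ marked-valid)
                                        (ι-involutive _ ∘′ marked-valid)
                                        (ι-sign _ ∘′ marked-valid) ⟩
    ∑ weight fixed                 ≡⟨ ∑-cong fixed weight≡1 ⟩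
    ∑ (λ _ → 1ℤ) fixed             ≡⟨ ∑-const 1ℤ fixed ⟩
    1ℤ ℤ.* + length fixed          ≡⟨ ℤP.*-identityˡ _ ⟩
    + length fixed                 ∎
    where
    open ≡-Reasoning
    weight≡1 : ∀ {t} → t ∈ fixed → weight t ≡ 1ℤ
    weight≡1 {t} t∈ with ∈-filter⁻ (λ t → ι t ≟ₘ t) t∈
    ... | t∈marked , ιt≡t with ι-fixed t (marked-valid t∈marked) ιt≡t
    ...   | ((_ , odds) , _) , odd , _ =
      trans (weight-oddMarked t odds) (sign-even (suc (mult t)) (even-suc (mult t) odd))

  module _ (M : List (List ℕ)) (M! : Unique M)
           (M-spec : ∀ λ′ → (λ′ ∈ M → Special n λ′) × (Special n λ′ → λ′ ∈ M)) where

    fixed-special : ∀ {t} → t ∈ fixed → Special n (unmark t)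
    fixed-special {t@(o , k , b)} t∈ with ∈-filter⁻ (λ t → ι t ≟ₘ t) t∈
    ... | t∈marked , ιt≡t with marked-valid t∈marked
    ...   | v with ι-fixed t v ιt≡t
    ...     | (dl , k≥1 , _) , odd , unpaired =
      unmark-partition t v , k , b , o , k≥1 , odd , dl ,
      ↭-trans (unmark-↭ t) (++-comm (replicate b (2 * k)) o) , unpaired

    special-fixed : ∀ {λ′} → Special n λ′ → λ′ ∈ map unmark fixed
    special-fixed {λ′} ((λ′↗ , _ , sum≡n) , k , b , o , k≥1 , odd , dl , λ′↭ , unpaired) =
      subst (_∈ map unmark fixed) unmark≡ (∈-map⁺ unmark t∈fixed)
      where
      t = o , k , b
      unmark↭ : unmark t ↭ λ′
      unmark↭ = ↭-trans (unmark-↭ t) (↭-trans (++-comm (replicate b (2 * k)) o) (↭-sym λ′↭))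
      unmark≡ : unmark t ≡ λ′
      unmark≡ = sorted-↭⇒≡ (insertAll-sorted (replicate b (2 * k)) (distinctOdd-sorted dl)) λ′↗ unmark↭
      size≡n : size t ≡ n
      size≡n = trans (sym (sum-replicate-++ b (2 * k) o))
                     (trans (sum-↭ (↭-trans (↭-sym (unmark-↭ t)) unmark↭)) sum≡n)
      t∈fixed : t ∈ fixed
      t∈fixed = ∈-filter⁺ (λ t → ι t ≟ₘ t) (marked-complete (oddMarked-valid (dl , k≥1 , odd⇒≥1 odd) size≡n))
                          (unpaired⇒ι-fixed t dl odd unpaired)

    fixed↭M : map unmark fixed ↭ M
    fixed↭M = unique-↭ (map-unique unmark (Unique.filter⁺ (λ t → ι t ≟ₘ t) marked-unique) injective) M!
                        (λ λ′∈ → let t , t∈ , λ′≡ = ∈-map⁻ unmark λ′∈ in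
                                 proj₂ (M-spec _) (subst (Special n) (sym λ′≡) (fixed-special t∈)))
                        (special-fixed ∘′ proj₁ (M-spec _))
      where
      injective : ∀ {t t′} → t ∈ fixed → t′ ∈ fixed → unmark t ≡ unmark t′ → t ≡ t′
      injective {t} {t′} t∈ t′∈ with ∈-filter⁻ (λ t → ι t ≟ₘ t) t∈ | ∈-filter⁻ (λ t → ι t ≟ₘ t) t′∈
      ... | t∈m , ιt≡t | t′∈m , ιt′≡t′
        with ι-fixed t (marked-valid t∈m) ιt≡t | ι-fixed t′ (marked-valid t′∈m) ιt′≡t′
      ... | (dl , _ , b≥1) , _ | (dl′ , _ , _) , _ =
        unmark-injective (distinctOdd-sorted dl) (proj₂ dl) b≥1 (distinctOdd-sorted dl′) (proj₂ dl′)

corollary5p2 : (n : ℕ) → n ≥ 1 →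
  (L : List (List ℕ)) → Unique L →
  ((λ′ : List ℕ) → (λ′ ∈ L → IsPartition n λ′) × (IsPartition n λ′ → λ′ ∈ L)) →
  (M : List (List ℕ)) → Unique M →
  ((λ′ : List ℕ) → (λ′ ∈ M → Special n λ′) × (Special n λ′ → λ′ ∈ M)) →
  (+ sumOddℓev L) - (+ sumEvenℓev L) ≡ + length M
corollary5p2 n _ L L! L-spec M M! M-spec = begin
  + sumOddℓev L - + sumEvenℓev L                     ≡⟨ odd-minus-even ℓev L ⟩
  ∑ (λ λ′ → sign (suc (ℓev λ′)) ℤ.* + ℓev λ′) L    ≡⟨ ∑-marked ⟨
  ∑ weight marked                                   ≡⟨ ∑-fixed ⟩
  + length fixed                                    ≡⟨ cong +_ (length-map unmark fixed) ⟨
  + length (map unmark fixed)                       ≡⟨ cong +_ (↭-length (fixed↭M M M! M-spec)) ⟩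
  + length M                                        ∎
  where
  open ≡-Reasoning
  open Enumeration n L L! L-spec
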